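{- Let $\ell\ge3$. Every $\ell$-core is a node of the ladder crystal $ladd_\ell$. Moreover, if $\lambda$ is an $\ell$-core and $0\le i<\ell$, then $\widehat\varphi_i(\lambda)=\varphi_i(\lambda)$ and $\widehat f_i^{\widehat\varphi_i(\lambda)}\lambda=\tilde f_i^{\varphi_i(\lambda)}\lambda$.
   Context: Partitions are identified with Young diagrams; the box $(x,y)$ has residue $y-x\bmod\ell$. An $\ell$-core is a partition none of whose hook lengths is divisible by $\ell$. For a residue $i$, mark removable boxes of residue $i$ by $-$ and addable positions of residue $i$ by $+$. Misra–Miwa operators $\tilde e_i,\tilde f_i$: read the signs from the bottom row to the top row; ladder operators $\widehat e_i,\widehat f_i$: order positions $(x,y)$ by ladder number $x+(\ell-1)(y-1)$ increasing (leftmost ladder first), and within a ladder from top to bottom (row index increasing), and read the signs in this order. In either case successively cancel adjacent pairs $-+$ to get the reduced signature; $e$ removes the box of the leftmost remaining $-$ and $f$ adds the box of the rightmost remaining $+$ (giving $0$ if none). $\varphi_i(\lambda)=\max\{n:\tilde f_i^n\lambda\neq0\}$, $\widehat\varphi_i(\lambda)=\max\{n:\widehat f_i^n\lambda\ne0\}$. The ladder crystal $ladd_\ell$ is the set of partitions obtained from the empty partition by finite sequences of the operators $\widehat f_i$, with operators $\widehat e_i,\widehat f_i$; it is isomorphic as a crystal to the Misra–Miwa crystal on $\ell$-regular partitions via regularization (moving every box to the top of its ladder). -}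

module Defs where

open import Data.Nat using (ℕ; zero; suc; _+_; _*_; _∸_; _≤_; _<_; _<ᵇ_; _≤ᵇ_; _≡ᵇ_; NonZero)
open import Data.Nat.Divisibility using (_∣_)
open import Data.Integer using (+_; _-_)
open import Data.Integer.DivMod using (_%ℕ_)
open import Data.Fin using (Fin; toℕ)
open import Data.Bool using (Bool; true; false; if_then_else_; _∧_; _∨_)
open import Data.List using (List; []; _∷_; length; reverse; [_]; _++_)
open import Data.List.Relation.Unary.All using (All)
open import Data.List.Relation.Unary.Linked using (Linked)
open import Data.Maybe using (Maybe; just; nothing; _>>=_)
open import Data.Product using (_×_; _,_)
open import Relation.Binary.PropositionalEquality using (_≡_; _≢_)
open import Relation.Nullary using (¬_)

-- Partitions.  A partition is a list of parts λ₁ ∷ λ₂ ∷ … (row 1 first),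
-- all positive and weakly decreasing.  Rows and columns are 1-based;
-- a box/position (x , y) lies in row x and column y.

IsPartition : List ℕ → Set
IsPartition p = Linked (λ a b → b ≤ a) p × All (λ a → 0 < a) p

part : List ℕ → ℕ → ℕ
part []       _             = 0
part (a ∷ p)  zero          = 0
part (a ∷ p)  (suc zero)    = a
part (a ∷ p)  (suc (suc r)) = part p (suc r)

colLen : List ℕ → ℕ → ℕ
colLen []      c = 0
colLen (a ∷ p) c = if c ≤ᵇ a then suc (colLen p c) else colLen p c

hook : List ℕ → ℕ → ℕ → ℕ
hook p r c = (part p r ∸ c) + (colLen p c ∸ r) + 1

IsCore : ℕ → List ℕ → Set
IsCore ℓ p = ∀ r c → 1 ≤ r → 1 ≤ c → c ≤ part p r → ¬ (ℓ ∣ hook p r c)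

residue : (ℓ : ℕ) .{{_ : NonZero ℓ}} → ℕ → ℕ → ℕ
residue ℓ x y = (+ y - + x) %ℕ ℓ

ladder : ℕ → ℕ → ℕ → ℕ
ladder ℓ x y = x + (ℓ ∸ 1) * (y ∸ 1)

data Sign : Set where
  plus minus : Sign

-- a signed position: (row , column , sign)
SPos : Set
SPos = ℕ × ℕ × Sign

-- All removable boxes (sign minus) and addable positions (sign plus),
-- listed row by row from top to bottom.
lessThanPrev : ℕ → Maybe ℕ → Bool
lessThanPrev a nothing  = true
lessThanPrev a (just b) = a <ᵇ b

headOr0 : List ℕ → ℕ
headOr0 []      = 0
headOr0 (b ∷ _) = b

allSigns : ℕ → Maybe ℕ → List ℕ → List SPos
allSigns r prev []      = [ (r , 1 , plus) ]
allSigns r prev (a ∷ p) = addable ++ (removable ++ allSigns (suc r) (just a) p)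
  where
    addableHere : Bool
    addableHere = lessThanPrev a prev
    next : ℕ
    next = headOr0 p
    addable : List SPos
    addable = if addableHere then [ (r , suc a , plus) ] else []
    removable : List SPos
    removable = if next <ᵇ a then [ (r , a , minus) ] else []

filterRes : (ℓ : ℕ) .{{_ : NonZero ℓ}} → ℕ → List SPos → List SPos
filterRes ℓ i []                  = []
filterRes ℓ i ((x , y , s) ∷ xs) =
  if residue ℓ x y ≡ᵇ i then (x , y , s) ∷ filterRes ℓ i xs else filterRes ℓ i xs

signsTopDown : (ℓ : ℕ) .{{_ : NonZero ℓ}} → ℕ → List ℕ → List SPos
signsTopDown ℓ i p = filterRes ℓ i (allSigns 1 nothing p)

-- Misra–Miwa reading order: from the bottom row to the top row
signsMM : (ℓ : ℕ) .{{_ : NonZero ℓ}} → ℕ → List ℕ → List SPos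
signsMM ℓ i p = reverse (signsTopDown ℓ i p)

before : ℕ → SPos → SPos → Bool
before ℓ (x , y , _) (x' , y' , _) =
  (ladder ℓ x y <ᵇ ladder ℓ x' y') ∨ ((ladder ℓ x y ≡ᵇ ladder ℓ x' y') ∧ (x ≤ᵇ x'))

insert : ℕ → SPos → List SPos → List SPos
insert ℓ s []       = [ s ]
insert ℓ s (t ∷ ts) = if before ℓ s t then s ∷ t ∷ ts else t ∷ insert ℓ s ts

sortLadder : ℕ → List SPos → List SPos
sortLadder ℓ []       = []
sortLadder ℓ (s ∷ ss) = insert ℓ s (sortLadder ℓ ss)

signsLadder : (ℓ : ℕ) .{{_ : NonZero ℓ}} → ℕ → List ℕ → List SPos
signsLadder ℓ i p = sortLadder ℓ (signsTopDown ℓ i p)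

cancelStep : List SPos → List SPos
cancelStep []                                       = []
cancelStep (a ∷ [])                                 = a ∷ []
cancelStep ((x , y , minus) ∷ (x' , y' , plus) ∷ r) = r
cancelStep (a ∷ b ∷ r)                              = a ∷ cancelStep (b ∷ r)

iterCancel : ℕ → List SPos → List SPos
iterCancel zero    w = w
iterCancel (suc n) w = iterCancel n (cancelStep w)

-- each step removes a pair or does nothing, so length w steps suffice
reduced : List SPos → List SPos
reduced w = iterCancel (length w) w

rightmostPlus : List SPos → Maybe ℕ
rightmostPlus []                   = nothing
rightmostPlus ((x , y , s) ∷ w) with rightmostPlus w | s
... | just r  | _     = just r
... | nothing | plus  = just x
... | nothing | minus = nothing

leftmostMinus : List SPos → Maybe ℕ
leftmostMinus []                       = nothing
leftmostMinus ((x , y , minus) ∷ w) = just x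
leftmostMinus ((x , y , plus)  ∷ w) = leftmostMinus w

-- add a box at the end of row r (row r may be the new row after the last)
addBox : ℕ → List ℕ → List ℕ
addBox zero          p       = p
addBox (suc zero)    []      = [ 1 ]
addBox (suc zero)    (a ∷ p) = suc a ∷ p
addBox (suc (suc r)) []      = []
addBox (suc (suc r)) (a ∷ p) = a ∷ addBox (suc r) p

removeBox : ℕ → List ℕ → List ℕ
removeBox zero          p             = p
removeBox (suc zero)    []            = []
removeBox (suc zero)    (suc zero ∷ p) = p
removeBox (suc zero)    (a ∷ p)       = (a ∸ 1) ∷ p
removeBox (suc (suc r)) []            = []
removeBox (suc (suc r)) (a ∷ p)       = a ∷ removeBox (suc r) p

-- generic operators given a reading order ("nothing" plays the role of 0)
fOp : (List ℕ → List SPos) → List ℕ → Maybe (List ℕ)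
fOp sig p with rightmostPlus (reduced (sig p))
... | nothing = nothing
... | just r  = just (addBox r p)

eOp : (List ℕ → List SPos) → List ℕ → Maybe (List ℕ)
eOp sig p with leftmostMinus (reduced (sig p))
... | nothing = nothing
... | just r  = just (removeBox r p)

-- Misra–Miwa operators f̃ᵢ, ẽᵢ
fMM eMM : (ℓ : ℕ) .{{_ : NonZero ℓ}} → Fin ℓ → List ℕ → Maybe (List ℕ)
fMM ℓ i = fOp (signsMM ℓ (toℕ i))
eMM ℓ i = eOp (signsMM ℓ (toℕ i))

-- ladder operators f̂ᵢ, êᵢ
fLad eLad : (ℓ : ℕ) .{{_ : NonZero ℓ}} → Fin ℓ → List ℕ → Maybe (List ℕ)
fLad ℓ i = fOp (signsLadder ℓ (toℕ i))
eLad ℓ i = eOp (signsLadder ℓ (toℕ i))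

iter : (List ℕ → Maybe (List ℕ)) → ℕ → List ℕ → Maybe (List ℕ)
iter f zero    p = just p
iter f (suc n) p = iter f n p >>= f

-- n = max { m : f^m p ≠ 0 }   (so φᵢ(p) = n for f = f̃ᵢ, φ̂ᵢ(p) = n for f = f̂ᵢ)
IsMaxIter : (List ℕ → Maybe (List ℕ)) → List ℕ → ℕ → Set
IsMaxIter f p n = (iter f n p ≢ nothing) × (∀ m → iter f m p ≢ nothing → m ≤ n)

-- nodes of the ladder crystal ladd_ℓ: reachable from ∅ by the f̂ᵢ
data InLadd (ℓ : ℕ) .{{_ : NonZero ℓ}} : List ℕ → Set where
  empty : InLadd ℓ []
  step  : ∀ {p q} (i : Fin ℓ) → InLadd ℓ p → fLad ℓ i p ≡ just q → InLadd ℓ q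

module Submission where

-- The argument only needs ℓ ≥ 2.
--
-- Key fact (core-unmixed): an ℓ-core never has an addable i-position and a
-- removable i-box at the same time, for the box in the upper of the two
-- rows and the column of the lower one would have a hook divisible by ℓ.
-- So the i-signature is all plus or all minus and no − + pair cancels:
--   * all minus: both operators give 0 at once, φ = 0 (φ-zero);
--   * all plus: in any reading order the operator adds the addable
--     i-positions one at a time until none is left (AddAll), so φ is their
--     number and f^φ adds all of them, whatever the order (φ-agree).
-- Membership in the ladder crystal is by induction on the size: for the
-- residue i of the last box of the last row the signature is all minus;
-- removing all removable i-boxes gives a smaller core q whose signature is
-- all plus, and f̂ᵢ^φ(q) q = p (RemoveAll, core-InLadd).

open import Defs
open import Data.Bool using (Bool; true; false; if_then_else_; T)
open import Data.Empty using (⊥; ⊥-elim)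
open import Data.Fin using (Fin; toℕ; fromℕ<)
open import Data.Fin.Properties using (toℕ-fromℕ<)
import Data.Integer as ℤ
import Data.Integer.Properties as ℤP
open import Data.Integer.DivMod using (_%ℕ_)
open import Data.List using (List; []; _∷_; _++_; [_]; map; reverse; length)
open import Data.List.Properties using (++-assoc; map-++; map-id-local; reverse-map; length-reverse; unfold-reverse)
open import Data.List.Membership.Propositional using (_∈_)
open import Data.List.Membership.Propositional.Properties using (∈-map⁺; ∈-map⁻; ∈-++⁺ˡ; ∈-++⁺ʳ; ∈-++⁻)
open import Data.List.Relation.Unary.Any using (here; there)
import Data.List.Relation.Unary.Any.Properties as AnyP
open import Data.List.Relation.Unary.All as All using (All; []; _∷_)
import Data.List.Relation.Unary.All.Properties as AllP
open import Data.List.Relation.Unary.AllPairs using (AllPairs; []; _∷_)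
open import Data.List.Relation.Unary.Linked using (Linked; _∷_)
open import Data.Maybe using (Maybe; just; nothing; _>>=_)
open import Data.Nat
open import Data.Nat.Properties
open import Data.Nat.DivMod
open import Data.Nat.Divisibility
open import Data.Nat.ListAction using (sum)
open import Data.Nat.Tactic.RingSolver using (solve-∀)
open import Data.Product using (Σ; _×_; _,_; proj₁; proj₂; ∃-syntax)
open import Data.Sum using (_⊎_; inj₁; inj₂)
open import Data.Unit using (⊤; tt)
open import Relation.Binary.Definitions using (tri<; tri≈; tri>)
open import Relation.Binary.PropositionalEquality hiding ([_])
open import Relation.Nullary using (yes; no; ¬_)

-- Residue arithmetic for ℓ = suc k.  The residue y - x mod ℓ of a box
-- (x , y) is represented by the natural number  content x y = y + k x,
-- which is congruent to y - x modulo ℓ.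
module Residues (k : ℕ) where

  ℓ : ℕ
  ℓ = suc k

  content : ℕ → ℕ → ℕ
  content x y = y + x * k

  res : ℕ → ℕ → ℕ
  res x y = content x y % ℓ

  -- the residue of a box strictly below the main diagonal (y - x = -(d+1))
  residue-below-diagonal : ∀ d y → ℤ.-[1+ d ] %ℕ ℓ ≡ (y + (y + suc d) * k) % ℓ
  residue-below-diagonal d y with suc d % ℓ in eq
  ... | zero = sym (trans (cong (_% ℓ) ar) ([m+kn]%n≡m%n 0 (y + q * k) ℓ))
    where
      q = suc d / ℓ
      d≡ : suc d ≡ q * ℓ
      d≡ = trans (m≡m%n+[m/n]*n (suc d) ℓ) (cong (_+ q * ℓ) eq)
      ring : ∀ y q k → y + (y + q * suc k) * k ≡ 0 + (y + q * k) * suc k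
      ring = solve-∀
      ar : y + (y + suc d) * k ≡ 0 + (y + q * k) * ℓ
      ar = trans (cong (λ z → y + (y + z) * k) d≡) (ring y q k)
  ... | suc j = sym (trans (cong (_% ℓ) ar) (trans ([m+kn]%n≡m%n e (y + j + q * k) ℓ) (m<n⇒m%n≡m e<ℓ)))
    where
      q = suc d / ℓ
      d≡ : suc d ≡ suc j + q * ℓ
      d≡ = trans (m≡m%n+[m/n]*n (suc d) ℓ) (cong (_+ q * ℓ) eq)
      j≤k : j ≤ k
      j≤k = ≤-pred (<⇒≤ (subst (_< ℓ) eq (m%n<n (suc d) ℓ)))
      e = k ∸ j
      k≡ : k ≡ j + e
      k≡ = sym (m+[n∸m]≡n j≤k)
      e<ℓ : e < ℓ
      e<ℓ = s≤s (m∸n≤m k j)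
      ring : ∀ y j q e → y + (y + (suc j + q * suc (j + e))) * (j + e) ≡ e + (y + j + q * (j + e)) * suc (j + e)
      ring = solve-∀
      ar : y + (y + suc d) * k ≡ e + (y + j + q * k) * ℓ
      ar = begin
        y + (y + suc d) * k                          ≡⟨ cong (λ z → y + (y + z) * k) d≡ ⟩
        y + (y + (suc j + q * ℓ)) * k                ≡⟨ cong (λ z → y + (y + (suc j + q * suc z)) * z) k≡ ⟩
        y + (y + (suc j + q * suc (j + e))) * (j + e) ≡⟨ ring y j q e ⟩
        e + (y + j + q * (j + e)) * suc (j + e)      ≡⟨ cong (λ z → e + (y + j + q * z) * suc z) (sym k≡) ⟩
        e + (y + j + q * k) * ℓ                      ∎
        where open ≡-Reasoning

  residue≡res : ∀ x y → residue ℓ x y ≡ res x y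
  residue≡res x y with x ≤? y
  ... | yes x≤y = begin
      residue ℓ x y              ≡⟨ cong (_%ℕ ℓ) (trans (ℤP.m-n≡m⊖n y x) (ℤP.⊖-≥ x≤y)) ⟩
      (y ∸ x) % ℓ                ≡⟨ sym ([m+kn]%n≡m%n (y ∸ x) x ℓ) ⟩
      ((y ∸ x) + x * ℓ) % ℓ      ≡⟨ cong (_% ℓ) ar ⟩
      res x y                    ∎
    where
      open ≡-Reasoning
      ring : ∀ d x k → d + x * suc k ≡ (x + d) + x * k
      ring = solve-∀
      ar : (y ∸ x) + x * ℓ ≡ content x y
      ar = trans (ring (y ∸ x) x k) (cong (_+ x * k) (m+[n∸m]≡n x≤y))
  ... | no x≰y = begin
      residue ℓ x y                     ≡⟨ cong (_%ℕ ℓ) (trans (ℤP.m-n≡m⊖n y x) (ℤP.⊖-< y<x)) ⟩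
      (ℤ.- (ℤ.+ (x ∸ y))) %ℕ ℓ          ≡⟨ cong (λ z → (ℤ.- (ℤ.+ z)) %ℕ ℓ) (+-∸-assoc 1 y<x) ⟩
      ℤ.-[1+ d ] %ℕ ℓ                   ≡⟨ residue-below-diagonal d y ⟩
      (y + (y + suc d) * k) % ℓ         ≡⟨ cong (λ z → (y + z * k) % ℓ) (sym x≡) ⟩
      res x y                           ∎
    where
      open ≡-Reasoning
      y<x = ≰⇒> x≰y
      d = x ∸ suc y
      x≡ : x ≡ y + suc d
      x≡ = trans (sym (m+[n∸m]≡n (<⇒≤ y<x))) (cong (y +_) (+-∸-assoc 1 y<x))

  congruent⇒∣ : ∀ h a b m → h + b ≡ a + m * ℓ → a % ℓ ≡ b % ℓ → ℓ ∣ h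
  congruent⇒∣ h a b m e a≡b = ∣m+n∣m⇒∣n (divides (a / ℓ + m) multiple) (divides (b / ℓ) refl)
    where
      open ≡-Reasoning
      ring₁ : ∀ u v w → u + (v + w) ≡ w + (u + v)
      ring₁ = solve-∀
      ring₂ : ∀ u v w z → u + v * z + w * z ≡ u + (v + w) * z
      ring₂ = solve-∀
      multiple : (b / ℓ) * ℓ + h ≡ (a / ℓ + m) * ℓ
      multiple = +-cancelˡ-≡ (b % ℓ) _ _ (begin
        b % ℓ + ((b / ℓ) * ℓ + h)    ≡⟨ ring₁ (b % ℓ) ((b / ℓ) * ℓ) h ⟩
        h + (b % ℓ + (b / ℓ) * ℓ)    ≡⟨ cong (h +_) (sym (m≡m%n+[m/n]*n b ℓ)) ⟩
        h + b                        ≡⟨ e ⟩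
        a + m * ℓ                    ≡⟨ cong (_+ m * ℓ) (m≡m%n+[m/n]*n a ℓ) ⟩
        a % ℓ + (a / ℓ) * ℓ + m * ℓ  ≡⟨ cong (λ z → z + (a / ℓ) * ℓ + m * ℓ) a≡b ⟩
        b % ℓ + (a / ℓ) * ℓ + m * ℓ  ≡⟨ ring₂ (b % ℓ) (a / ℓ) m ℓ ⟩
        b % ℓ + (a / ℓ + m) * ℓ      ∎)

  ∣⇒congruent : ∀ h a b m → h + b ≡ a + m * ℓ → ℓ ∣ h → a % ℓ ≡ b % ℓ
  ∣⇒congruent .(q * ℓ) a b m e (divides q refl) = begin
      a % ℓ             ≡⟨ sym ([m+kn]%n≡m%n a m ℓ) ⟩
      (a + m * ℓ) % ℓ   ≡⟨ cong (_% ℓ) (sym e) ⟩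
      (q * ℓ + b) % ℓ   ≡⟨ cong (_% ℓ) (+-comm (q * ℓ) b) ⟩
      (b + q * ℓ) % ℓ   ≡⟨ [m+kn]%n≡m%n b q ℓ ⟩
      b % ℓ             ∎
    where open ≡-Reasoning

  %-cong-+ : ∀ a b c → a % ℓ ≡ b % ℓ → (a + c) % ℓ ≡ (b + c) % ℓ
  %-cong-+ a b c e = begin
      (a + c) % ℓ               ≡⟨ %-distribˡ-+ a c ℓ ⟩
      (a % ℓ + c % ℓ) % ℓ       ≡⟨ cong (λ z → (z + c % ℓ) % ℓ) e ⟩
      (b % ℓ + c % ℓ) % ℓ       ≡⟨ sym (%-distribˡ-+ b c ℓ) ⟩
      (b + c) % ℓ               ∎
    where open ≡-Reasoning

  res-diagonal : ∀ x y → res (suc x) (suc y) ≡ res x y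
  res-diagonal x y = trans (cong (_% ℓ) (ring x y k)) ([m+kn]%n≡m%n (content x y) 1 ℓ)
    where
      ring : ∀ x y k → suc y + suc x * k ≡ (y + x * k) + 1 * suc k
      ring = solve-∀

  res-shift-right : ∀ x y x' y' → res x y ≡ res x' y' → res x (suc y) ≡ res x' (suc y')
  res-shift-right x y x' y' e =
    subst₂ (λ u v → u % ℓ ≡ v % ℓ) (+-comm (content x y) 1) (+-comm (content x' y') 1)
      (%-cong-+ (content x y) (content x' y') 1 e)

  res-shift-left : ∀ x y x' y' → res x (suc y) ≡ res x' (suc y') → res x y ≡ res x' y'
  res-shift-left x y x' y' e =
    trans (sym (back x y)) (trans (%-cong-+ (content x (suc y)) (content x' (suc y')) k e) (back x' y'))
    where
      ring : ∀ x y k → (suc y + x * k) + k ≡ (y + x * k) + 1 * suc k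
      ring = solve-∀
      back : ∀ x y → (content x (suc y) + k) % ℓ ≡ res x y
      back x y = trans (cong (_% ℓ) (ring x y k)) ([m+kn]%n≡m%n (content x y) 1 ℓ)

  ℓ∤1 : 1 ≤ k → ¬ (ℓ ∣ 1)
  ℓ∤1 k≥1 d = <-irrefl (sym (suc-injective (∣1⇒≡1 d))) k≥1

  right-neighbour-res : 1 ≤ k → ∀ x y → res x y ≢ res x (suc y)
  right-neighbour-res k≥1 x y e =
    ℓ∤1 k≥1 (congruent⇒∣ 1 (content x (suc y)) (content x y) 0 (sym (+-identityʳ _)) (sym e))

  lower-neighbour-res : 1 ≤ k → ∀ x y → res x y ≢ res (suc x) y
  lower-neighbour-res k≥1 x y e = ℓ∤1 k≥1 (congruent⇒∣ 1 (content x y) (content (suc x) y) 1 (ring x y k) e)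
    where
      ring : ∀ x y k → 1 + (y + suc x * k) ≡ (y + x * k) + 1 * suc k
      ring = solve-∀

  -- Hence ℓ divides the hook exactly when the addable position at the end of
  -- row r and the bottom box of column c have the same residue.
  hook-content : ∀ r m c λr → c ≤ λr → r ≤ m →
    ((λr ∸ c) + (m ∸ r) + 1) + content m c ≡ content r (suc λr) + (m ∸ r) * ℓ
  hook-content r m c λr c≤ r≤ with m≤n⇒∃[o]m+o≡n c≤ | m≤n⇒∃[o]m+o≡n r≤
  ... | u , refl | d , refl rewrite m+n∸m≡n c u | m+n∸m≡n r d = ring r d c u k
    where
      ring : ∀ r d c u k → (u + d + 1) + (c + (r + d) * k) ≡ (suc (c + u) + r * k) + d * suc k
      ring = solve-∀

  hook-divisible⇒ : ∀ p r c m → colLen p c ≡ m → c ≤ part p r → r ≤ m →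
    ℓ ∣ hook p r c → res r (suc (part p r)) ≡ res m c
  hook-divisible⇒ p r c m refl c≤ r≤ =
    ∣⇒congruent _ _ _ (m ∸ r) (hook-content r m c (part p r) c≤ r≤)

  hook-divisible⇐ : ∀ p r c m → colLen p c ≡ m → c ≤ part p r → r ≤ m →
    res r (suc (part p r)) ≡ res m c → ℓ ∣ hook p r c
  hook-divisible⇐ p r c m refl c≤ r≤ =
    congruent⇒∣ _ _ _ (m ∸ r) (hook-content r m c (part p r) c≤ r≤)

δ : ℕ → ℕ → ℕ
δ a x = if a ≡ᵇ x then 1 else 0

δ-self : ∀ x → δ x x ≡ 1
δ-self zero    = refl
δ-self (suc x) = δ-self x

δ-≢ : ∀ x r → x ≢ r → δ x r ≡ 0
δ-≢ x r x≢r with x ≡ᵇ r in eq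
... | false = refl
... | true  = ⊥-elim (x≢r (≡ᵇ⇒≡ x r (subst T (sym eq) tt)))

Addable : List ℕ → ℕ → Set
Addable p zero          = ⊥
Addable p (suc zero)    = ⊤
Addable p (suc (suc x)) = part p (suc (suc x)) < part p (suc x)

Removable : List ℕ → ℕ → Set
Removable p x = part p (suc x) < part p x

Positive : List ℕ → Set
Positive = All (λ a → 0 < a)

Decreasing : List ℕ → Set
Decreasing p = ∀ r → part p (suc (suc r)) ≤ part p (suc r)

part-zero : ∀ p → part p 0 ≡ 0
part-zero []      = refl
part-zero (a ∷ p) = refl

row0-not-removable : ∀ p → ¬ Removable p 0
row0-not-removable p h = n≮0 (subst (part p 1 <_) (part-zero p) h)

removable⇒row≥1 : ∀ p x → Removable p x → 1 ≤ x
removable⇒row≥1 p zero    h = ⊥-elim (row0-not-removable p h)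
removable⇒row≥1 p (suc _) _ = s≤s z≤n

linked⇒decreasing : ∀ p → Linked (λ a b → b ≤ a) p → Decreasing p
linked⇒decreasing []          _       r       = z≤n
linked⇒decreasing (a ∷ [])    _       r       = z≤n
linked⇒decreasing (a ∷ b ∷ p) (h ∷ l) zero    = h
linked⇒decreasing (a ∷ b ∷ p) (h ∷ l) (suc r) = linked⇒decreasing (b ∷ p) l r

part-ext : ∀ p q → Positive p → Positive q → (∀ r → part p r ≡ part q r) → p ≡ q
part-ext []      []      _        _        e = refl
part-ext []      (b ∷ q) _        (h ∷ _)  e = ⊥-elim (<-irrefl (e 1) h)
part-ext (a ∷ p) []      (h ∷ _)  _        e = ⊥-elim (<-irrefl (sym (e 1)) h)
part-ext (a ∷ p) (b ∷ q) (_ ∷ ap) (_ ∷ aq) e = cong₂ _∷_ (e 1) (part-ext p q ap aq e')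
  where
    e' : ∀ r → part p r ≡ part q r
    e' zero    = trans (part-zero p) (sym (part-zero q))
    e' (suc r) = e (suc (suc r))

part-addBox : ∀ x p r → Addable p x → part (addBox x p) r ≡ δ x r + part p r
part-addBox (suc zero)    []      zero          g = refl
part-addBox (suc zero)    []      (suc zero)    g = refl
part-addBox (suc zero)    []      (suc (suc r)) g = refl
part-addBox (suc zero)    (a ∷ p) zero          g = refl
part-addBox (suc zero)    (a ∷ p) (suc zero)    g = refl
part-addBox (suc zero)    (a ∷ p) (suc (suc r)) g = refl
part-addBox (suc (suc x)) (a ∷ p) zero          g = refl
part-addBox (suc (suc x)) (a ∷ p) (suc zero)    g = refl
part-addBox (suc (suc x)) (a ∷ p) (suc (suc r)) g = part-addBox (suc x) p (suc r) (tail x g)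
  where
    tail : ∀ x → Addable (a ∷ p) (suc (suc x)) → Addable p (suc x)
    tail zero    _ = tt
    tail (suc x) h = h

positive-addBox : ∀ x p → Positive p → Positive (addBox x p)
positive-addBox zero          p       ap       = ap
positive-addBox (suc zero)    []      ap       = s≤s z≤n ∷ []
positive-addBox (suc zero)    (a ∷ p) (_ ∷ ap) = s≤s z≤n ∷ ap
positive-addBox (suc (suc x)) []      ap       = []
positive-addBox (suc (suc x)) (a ∷ p) (h ∷ ap) = h ∷ positive-addBox (suc x) p ap

part-removeBox : ∀ x p r → Positive p → Removable p x → part (removeBox x p) r ≡ part p r ∸ δ x r
part-removeBox zero p r ap rm = ⊥-elim (row0-not-removable p rm)
part-removeBox (suc zero) (suc zero ∷ []) zero          ap rm = refl
part-removeBox (suc zero) (suc zero ∷ []) (suc zero)    ap rm = refl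
part-removeBox (suc zero) (suc zero ∷ []) (suc (suc r)) ap rm = refl
part-removeBox (suc zero) (suc zero ∷ b ∷ p) r (_ ∷ h ∷ _) rm = ⊥-elim (<-irrefl refl (<-≤-trans rm h))
part-removeBox (suc zero) (suc (suc a) ∷ p) zero          ap rm = refl
part-removeBox (suc zero) (suc (suc a) ∷ p) (suc zero)    ap rm = refl
part-removeBox (suc zero) (suc (suc a) ∷ p) (suc (suc r)) ap rm = refl
part-removeBox (suc (suc x)) (a ∷ p) zero          ap       rm = refl
part-removeBox (suc (suc x)) (a ∷ p) (suc zero)    ap       rm = refl
part-removeBox (suc (suc x)) (a ∷ p) (suc (suc r)) (_ ∷ ap) rm = part-removeBox (suc x) p (suc r) ap rm

positive-removeBox : ∀ x p → Positive p → Positive (removeBox x p)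
positive-removeBox zero          p                 ap       = ap
positive-removeBox (suc zero)    []                ap       = ap
positive-removeBox (suc zero)    (suc zero ∷ p)    (_ ∷ ap) = ap
positive-removeBox (suc zero)    (suc (suc a) ∷ p) (_ ∷ ap) = s≤s z≤n ∷ ap
positive-removeBox (suc (suc x)) []                ap       = ap
positive-removeBox (suc (suc x)) (a ∷ p)           (h ∷ ap) = h ∷ positive-removeBox (suc x) p ap

sum-removeBox : ∀ x p → Positive p → Removable p x → suc (sum (removeBox x p)) ≡ sum p
sum-removeBox zero          p                 ap       rm = ⊥-elim (row0-not-removable p rm)
sum-removeBox (suc zero)    (suc zero ∷ p)    ap       rm = refl
sum-removeBox (suc zero)    (suc (suc a) ∷ p) ap       rm = refl
sum-removeBox (suc (suc x)) (a ∷ p)           (_ ∷ ap) rm =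
  trans (sym (+-suc a _)) (cong (a +_) (sum-removeBox (suc x) p ap rm))

addable⇒row≥1 : ∀ p x → Addable p x → 1 ≤ x
addable⇒row≥1 p (suc _) _ = s≤s z≤n

part-antitone : ∀ p → Decreasing p → ∀ r r' → 1 ≤ r → r ≤ r' → part p r' ≤ part p r
part-antitone p d (suc r) r' _ le with m≤n⇒∃[o]m+o≡n le
... | j , refl = go j
  where
    go : ∀ j → part p (suc r + j) ≤ part p (suc r)
    go zero    rewrite +-identityʳ r = ≤-refl
    go (suc j) rewrite +-suc r j = ≤-trans (d (r + j)) (go j)

part≤head : ∀ a p → Decreasing (a ∷ p) → ∀ r → part (a ∷ p) r ≤ a
part≤head a p d zero    = z≤n
part≤head a p d (suc r) = part-antitone (a ∷ p) d 1 (suc r) (s≤s z≤n) (s≤s z≤n)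

colLen-zero : ∀ p c → Decreasing p → part p 1 < c → colLen p c ≡ 0
colLen-zero []      c d lt = refl
colLen-zero (a ∷ p) c d lt with c ≤ᵇ a in eq
... | true  = ⊥-elim (<-irrefl refl (<-≤-trans lt (≤ᵇ⇒≤ c a (subst T (sym eq) tt))))
... | false = colLen-zero p c (λ r → d (suc r)) (≤-<-trans (part≤head a p d 2) lt)

colLen-exact : ∀ p c → Decreasing p → 1 ≤ c → ∀ m →
  c ≤ part p (suc m) → part p (suc (suc m)) < c → colLen p c ≡ suc m
colLen-exact []      c d c≥1 m le lt = ⊥-elim (<-irrefl refl (<-≤-trans c≥1 le))
colLen-exact (a ∷ p) c d c≥1 m le lt with c ≤ᵇ a in eq
... | false = ⊥-elim (subst T eq (≤⇒≤ᵇ (≤-trans le (part≤head a p d (suc m)))))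
colLen-exact (a ∷ p) c d c≥1 zero    le lt | true = cong suc (colLen-zero p c (λ r → d (suc r)) lt)
colLen-exact (a ∷ p) c d c≥1 (suc m) le lt | true = cong suc (colLen-exact p c (λ r → d (suc r)) c≥1 m le lt)

removable⇒colLen : ∀ p c → Decreasing p → Removable p c → colLen p (part p c) ≡ c
removable⇒colLen p zero    d rm = ⊥-elim (row0-not-removable p rm)
removable⇒colLen p (suc c) d rm = colLen-exact p (part p (suc c)) d (≤-<-trans z≤n rm) c ≤-refl rm

addable⇒colLen : ∀ p z → Decreasing p → Addable p (suc (suc z)) → colLen p (suc (part p (suc (suc z)))) ≡ suc z
addable⇒colLen p z d g = colLen-exact p _ d (s≤s z≤n) z g ≤-refl

tailRow : ℕ → ℕ
tailRow (suc (suc r)) = suc r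
tailRow _             = 1

tailRow≥1 : ∀ r → 1 ≤ tailRow r
tailRow≥1 zero          = s≤s z≤n
tailRow≥1 (suc zero)    = s≤s z≤n
tailRow≥1 (suc (suc r)) = s≤s z≤n

colLen-box : ∀ p c → Decreasing p → 1 ≤ c → ∀ r → 1 ≤ r → c ≤ part p r →
  Σ ℕ λ m → colLen p c ≡ suc m × r ≤ suc m × c ≤ part p (suc m) × part p (suc (suc m)) < c
colLen-box [] c d c≥1 r r≥1 le = ⊥-elim (<-irrefl refl (<-≤-trans c≥1 (≤-trans le (≤-reflexive (part-[] r)))))
  where
    part-[] : ∀ r → part [] r ≡ 0
    part-[] zero    = refl
    part-[] (suc r) = refl
colLen-box (a ∷ p) c d c≥1 r r≥1 le with c ≤ᵇ a in eq
... | false = ⊥-elim (subst T eq (≤⇒≤ᵇ (≤-trans le (part≤head a p d r))))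
... | true with part p 1 <? c
...   | yes lt = 0 , cong suc (colLen-zero p c (λ r → d (suc r)) lt) , r≤1 r le , ≤ᵇ⇒≤ c a (subst T (sym eq) tt) , lt
  where
    r≤1 : ∀ r → c ≤ part (a ∷ p) r → r ≤ 1
    r≤1 zero          _   = z≤n
    r≤1 (suc zero)    _   = ≤-refl
    r≤1 (suc (suc r)) le' = ⊥-elim (<-irrefl refl (<-≤-trans lt (≤-trans le'
                              (part-antitone p (λ r → d (suc r)) 1 (suc r) (s≤s z≤n) (s≤s z≤n)))))
...   | no nlt with colLen-box p c (λ r → d (suc r)) c≥1 (tailRow r) (tailRow≥1 r) (le' r le)
  where
    le' : ∀ r → c ≤ part (a ∷ p) r → c ≤ part p (tailRow r)
    le' zero          _ = ≮⇒≥ nlt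
    le' (suc zero)    _ = ≮⇒≥ nlt
    le' (suc (suc r)) h = h
...   | m , e , r≤ , c≤ , <c = suc m , cong suc e , shift r r≥1 r≤ , c≤ , <c
  where
    shift : ∀ r → 1 ≤ r → tailRow r ≤ suc m → r ≤ suc (suc m)
    shift (suc zero)    _ _ = s≤s z≤n
    shift (suc (suc r)) _ h = s≤s h

AddableAfter : Maybe ℕ → List ℕ → ℕ → Set
AddableAfter prev p zero    = T (lessThanPrev (part p 1) prev)
AddableAfter prev p (suc j) = part p (suc (suc j)) < part p (suc j)

PositivePrev : Maybe ℕ → Set
PositivePrev nothing  = ⊤
PositivePrev (just a) = 0 < a

headOr0≡part1 : ∀ p → headOr0 p ≡ part p 1
headOr0≡part1 []      = refl
headOr0≡part1 (a ∷ p) = refl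

∈-if : ∀ {s t : SPos} (b : Bool) → s ∈ (if b then [ t ] else []) → T b × s ≡ t
∈-if true  (here e) = tt , e
∈-if false ()

if-∈ : ∀ {t : SPos} (b : Bool) → T b → t ∈ (if b then [ t ] else [])
if-∈ true _ = here refl

module RowBlocks (r : ℕ) (prev : Maybe ℕ) (a : ℕ) (p : List ℕ) where
  addableBlock removableBlock : List SPos
  addableBlock   = if lessThanPrev a prev then [ (r , suc a , plus) ] else []
  removableBlock = if headOr0 p <ᵇ a then [ (r , a , minus) ] else []

  later : ∀ {s} → s ∈ allSigns (suc r) (just a) p → s ∈ allSigns r prev (a ∷ p)
  later m = ∈-++⁺ʳ addableBlock (∈-++⁺ʳ removableBlock m)

plus∈allSigns⇒ : ∀ r prev p x y → Positive p → PositivePrev prev →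
  (x , y , plus) ∈ allSigns r prev p →
  Σ ℕ λ j → x ≡ r + j × y ≡ suc (part p (suc j)) × AddableAfter prev p j
plus∈allSigns⇒ r nothing  [] x y ap po (here refl) = 0 , sym (+-identityʳ r) , refl , tt
plus∈allSigns⇒ r (just b) [] x y ap po (here refl) = 0 , sym (+-identityʳ r) , refl , <⇒<ᵇ po
plus∈allSigns⇒ r prev (a ∷ p) x y (a>0 ∷ ap) po m with ∈-++⁻ (RowBlocks.addableBlock r prev a p) m
... | inj₁ m₁ with ∈-if (lessThanPrev a prev) m₁
...   | t , refl = 0 , sym (+-identityʳ r) , refl , t
plus∈allSigns⇒ r prev (a ∷ p) x y (a>0 ∷ ap) po m | inj₂ m₂ with ∈-++⁻ (RowBlocks.removableBlock r prev a p) m₂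
... | inj₁ m₃ with ∈-if (headOr0 p <ᵇ a) m₃
...   | _ , ()
plus∈allSigns⇒ r prev (a ∷ p) x y (a>0 ∷ ap) po m | inj₂ m₂ | inj₂ m₄
  with plus∈allSigns⇒ (suc r) (just a) p x y ap a>0 m₄
... | j , ex , ey , g = suc j , trans ex (sym (+-suc r j)) , ey , shift j g
  where
    shift : ∀ j → AddableAfter (just a) p j → AddableAfter prev (a ∷ p) (suc j)
    shift zero    g = <ᵇ⇒< _ _ g
    shift (suc j) g = g

addable⇒plus∈allSigns : ∀ r prev p j → AddableAfter prev p j →
  (r + j , suc (part p (suc j)) , plus) ∈ allSigns r prev p
addable⇒plus∈allSigns r prev []      zero    g rewrite +-identityʳ r = here refl
addable⇒plus∈allSigns r prev (a ∷ p) zero    g rewrite +-identityʳ r = ∈-++⁺ˡ (if-∈ (lessThanPrev a prev) g)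
addable⇒plus∈allSigns r prev (a ∷ p) (suc j) g rewrite +-suc r j =
  RowBlocks.later r prev a p (addable⇒plus∈allSigns (suc r) (just a) p j (shift j g))
  where
    shift : ∀ j → AddableAfter prev (a ∷ p) (suc j) → AddableAfter (just a) p j
    shift zero    g = <⇒<ᵇ g
    shift (suc j) g = g

minus∈allSigns⇒ : ∀ r prev p x y → (x , y , minus) ∈ allSigns r prev p →
  Σ ℕ λ j → x ≡ r + j × y ≡ part p (suc j) × part p (suc (suc j)) < part p (suc j)
minus∈allSigns⇒ r prev [] x y (here ())
minus∈allSigns⇒ r prev (a ∷ p) x y m with ∈-++⁻ (RowBlocks.addableBlock r prev a p) m
... | inj₁ m₁ with ∈-if (lessThanPrev a prev) m₁
...   | _ , ()
minus∈allSigns⇒ r prev (a ∷ p) x y m | inj₂ m₂ with ∈-++⁻ (RowBlocks.removableBlock r prev a p) m₂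
... | inj₁ m₃ with ∈-if (headOr0 p <ᵇ a) m₃
...   | t , refl = 0 , sym (+-identityʳ r) , refl , subst (_< a) (headOr0≡part1 p) (<ᵇ⇒< _ _ t)
minus∈allSigns⇒ r prev (a ∷ p) x y m | inj₂ m₂ | inj₂ m₄ with minus∈allSigns⇒ (suc r) (just a) p x y m₄
... | j , ex , ey , lt = suc j , trans ex (sym (+-suc r j)) , ey , lt

removable⇒minus∈allSigns : ∀ r prev p j → part p (suc (suc j)) < part p (suc j) →
  (r + j , part p (suc j) , minus) ∈ allSigns r prev p
removable⇒minus∈allSigns r prev (a ∷ p) zero lt rewrite +-identityʳ r =
  ∈-++⁺ʳ (RowBlocks.addableBlock r prev a p)
    (∈-++⁺ˡ (if-∈ (headOr0 p <ᵇ a) (<⇒<ᵇ (subst (_< a) (sym (headOr0≡part1 p)) lt))))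
removable⇒minus∈allSigns r prev (a ∷ p) (suc j) lt rewrite +-suc r j =
  RowBlocks.later r prev a p (removable⇒minus∈allSigns (suc r) (just a) p j lt)

signs : List ℕ → List SPos
signs p = allSigns 1 nothing p

plus∈signs⇒ : ∀ p x y → Positive p → (x , y , plus) ∈ signs p → Addable p x × y ≡ suc (part p x)
plus∈signs⇒ p x y ap m with plus∈allSigns⇒ 1 nothing p x y ap tt m
... | zero  , refl , ey , g = tt , ey
... | suc j , refl , ey , g = g , ey

addable⇒plus∈signs : ∀ p x → Addable p x → (x , suc (part p x) , plus) ∈ signs p
addable⇒plus∈signs p (suc zero)    g = addable⇒plus∈allSigns 1 nothing p 0 tt
addable⇒plus∈signs p (suc (suc j)) g = addable⇒plus∈allSigns 1 nothing p (suc j) g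

minus∈signs⇒ : ∀ p x y → (x , y , minus) ∈ signs p → Removable p x × y ≡ part p x
minus∈signs⇒ p x y m with minus∈allSigns⇒ 1 nothing p x y m
... | j , refl , ey , lt = lt , ey

removable⇒minus∈signs : ∀ p x → Removable p x → (x , part p x , minus) ∈ signs p
removable⇒minus∈signs p zero    rm = ⊥-elim (row0-not-removable p rm)
removable⇒minus∈signs p (suc j) rm = removable⇒minus∈allSigns 1 nothing p j rm

-- Every
-- signature we meet is strictly key-sorted, so it is determined by its
-- set of elements, and a one-signed sorted list has distinct rows.
row : SPos → ℕ
row (x , _ , _) = x

sgn : SPos → Sign
sgn (_ , _ , s) = s

key : SPos → ℕ
key (x , y , plus)  = x + x
key (x , y , minus) = suc (x + x)

KeySorted : List SPos → Set
KeySorted = AllPairs (λ s t → key s < key t)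

AllSign : Sign → List SPos → Set
AllSign σ = All (λ s → sgn s ≡ σ)

AllPlus AllMinus : List SPos → Set
AllPlus  = AllSign plus
AllMinus = AllSign minus

keySorted-unique : ∀ {xs ys : List SPos} → KeySorted xs → KeySorted ys →
  (∀ {s} → s ∈ xs → s ∈ ys) → (∀ {s} → s ∈ ys → s ∈ xs) → xs ≡ ys
keySorted-unique {[]}     {[]}     _ _ f g = refl
keySorted-unique {[]}     {y ∷ ys} _ _ f g with g (here refl)
... | ()
keySorted-unique {x ∷ xs} {[]}     _ _ f g with f (here refl)
... | ()
keySorted-unique {x ∷ xs} {y ∷ ys} (ax ∷ sx) (ay ∷ sy) f g = cong₂ _∷_ x≡y (keySorted-unique sx sy f' g')
  where
    x≡y : x ≡ y
    x≡y with f (here refl) | g (here refl)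
    ... | here e   | _       = e
    ... | there _  | here e  = sym e
    ... | there m₁ | there m₂ = ⊥-elim (<-asym (All.lookup ay m₁) (All.lookup ax m₂))
    f' : ∀ {s} → s ∈ xs → s ∈ ys
    f' m with f (there m)
    ... | there m'  = m'
    ... | here refl = ⊥-elim (<-irrefl (cong key x≡y) (All.lookup ax m))
    g' : ∀ {s} → s ∈ ys → s ∈ xs
    g' m with g (there m)
    ... | there m'  = m'
    ... | here refl = ⊥-elim (<-irrefl (cong key (sym x≡y)) (All.lookup ay m))

SortedFrom : ℕ → List SPos → Set
SortedFrom n w = KeySorted w × All (λ s → n ≤ key s) w

prependIf : ∀ b t n w → n ≤ key t → SortedFrom (suc (key t)) w →
  SortedFrom n ((if b then [ t ] else []) ++ w)
prependIf true  t n w n≤ (ks , lb) = (lb ∷ ks) , (n≤ ∷ All.map (λ h → ≤-trans n≤ (≤-trans (n≤1+n _) h)) lb)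
prependIf false t n w n≤ (ks , lb) = ks , All.map (λ h → ≤-trans n≤ (≤-trans (n≤1+n _) h)) lb

allSigns-sorted : ∀ r prev p → SortedFrom (r + r) (allSigns r prev p)
allSigns-sorted r prev []      = ([] ∷ []) , (≤-refl ∷ [])
allSigns-sorted r prev (a ∷ p) =
  prependIf (lessThanPrev a prev) (r , suc a , plus) (r + r) _ ≤-refl
    (prependIf (headOr0 p <ᵇ a) (r , a , minus) (suc (r + r)) _ ≤-refl
      (subst (λ n → SortedFrom n (allSigns (suc r) (just a) p)) (cong suc (+-suc r r))
        (allSigns-sorted (suc r) (just a) p)))

cnt : List SPos → ℕ → ℕ
cnt []                  x = 0
cnt ((a , b , c) ∷ w) x = δ a x + cnt w x

RowsDistinct : List SPos → Set
RowsDistinct w = ∀ x → cnt w x ≤ 1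

cnt-++ : ∀ xs ys x → cnt (xs ++ ys) x ≡ cnt xs x + cnt ys x
cnt-++ []                  ys x = refl
cnt-++ ((a , b , c) ∷ xs) ys x = trans (cong (δ a x +_) (cnt-++ xs ys x)) (sym (+-assoc (δ a x) _ _))

cnt-∈ : ∀ {s} w → s ∈ w → 1 ≤ cnt w (row s)
cnt-∈ ((a , b , c) ∷ w) (here refl) rewrite δ-self a = s≤s z≤n
cnt-∈ ((a , b , c) ∷ w) (there m)   = ≤-trans (cnt-∈ w m) (m≤n+m _ (δ a _))

cnt-witness : ∀ w x → 1 ≤ cnt w x → Σ SPos λ s → s ∈ w × row s ≡ x
cnt-witness ((a , b , c) ∷ w) x h with a ≟ x
... | yes refl = (a , b , c) , here refl , refl
... | no a≢x with cnt-witness w x (subst (λ z → 1 ≤ z + cnt w x) (δ-≢ a x a≢x) h)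
...   | s , m , e = s , there m , e

cnt-absent : ∀ w x → All (λ s → row s ≢ x) w → cnt w x ≡ 0
cnt-absent []                  x _        = refl
cnt-absent ((a , b , c) ∷ w) x (h ∷ hs) rewrite δ-≢ a x h = cnt-absent w x hs

cnt≤1 : ∀ w x → cnt w x ≤ 1 → cnt w x ≡ 0 ⊎ cnt w x ≡ 1
cnt≤1 w x h with cnt w x
... | zero          = inj₁ refl
... | suc zero      = inj₂ refl
... | suc (suc _)   with h
...   | s≤s ()

RowsDistinct-tail : ∀ e w → RowsDistinct (e ∷ w) → RowsDistinct w
RowsDistinct-tail (a , b , c) w d x = ≤-trans (m≤n+m _ (δ a x)) (d x)

RowsDistinct-head : ∀ x y σ w → RowsDistinct ((x , y , σ) ∷ w) → cnt w x ≡ 0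
RowsDistinct-head x y σ w d with d x
... | h rewrite δ-self x = n≤0⇒n≡0 (≤-pred h)

key<⇒row< : ∀ σ x x' y y' → key (x , y , σ) < key (x' , y' , σ) → x < x'
key<⇒row< σ x x' y y' h with x <? x'
... | yes lt = lt
... | no nlt = ⊥-elim (<-irrefl refl (<-≤-trans h (key-mono σ (≮⇒≥ nlt))))
  where
    key-mono : ∀ σ {x x'} → x' ≤ x → key (x' , y' , σ) ≤ key (x , y , σ)
    key-mono plus  le = +-mono-≤ le le
    key-mono minus le = s≤s (+-mono-≤ le le)

head-row-fresh : ∀ σ a b w → All (λ t → key (a , b , σ) < key t) w → AllSign σ w → All (λ s → row s ≢ a) w
head-row-fresh σ a b w h as = All.tabulate later≢
  where
    later≢ : ∀ {s} → s ∈ w → row s ≢ a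
    later≢ {x' , y' , c'} m e with All.lookup as m | All.lookup h m
    later≢ {.a , y' , .σ} m refl | refl | lt = <-irrefl refl (key<⇒row< σ a a b y' lt)

keySorted⇒rowsDistinct : ∀ σ w → KeySorted w → AllSign σ w → RowsDistinct w
keySorted⇒rowsDistinct σ []                   _        _          x = z≤n
keySorted⇒rowsDistinct σ ((a , b , .σ) ∷ w) (h ∷ ks) (refl ∷ as) x with a ≟ x
... | no a≢x rewrite δ-≢ a x a≢x = keySorted⇒rowsDistinct σ w ks as x
... | yes refl rewrite δ-self a | cnt-absent w a (head-row-fresh σ a b w h as) = s≤s z≤n

-- Adding the boxes of a set Q of plus-entries (one per row) turns exactly
-- those entries into minus-entries; `mark Q` performs this on a signature.
markSign : ℕ → Sign → Sign
markSign zero    σ = σ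
markSign (suc _) σ = minus

mark : List SPos → SPos → SPos
mark Q (x , y , σ) = (x , y , markSign (cnt Q x) σ)

mark-unmarked : ∀ Q s → cnt Q (row s) ≡ 0 → mark Q s ≡ s
mark-unmarked Q (x , y , σ) e rewrite e = refl

mark-marked : ∀ Q s → 1 ≤ cnt Q (row s) → sgn (mark Q s) ≡ minus
mark-marked Q (x , y , σ) h with cnt Q x
... | suc _ = refl

-- A reading order rearranges the entries of a signature without looking at
-- the signs: it commutes with marking, introduces no new entries and
-- preserves row counts and length.
record ReadingOrder : Set where
  field
    order        : List SPos → List SPos
    order-mark   : ∀ Q w → order (map (mark Q) w) ≡ map (mark Q) (order w)
    order-∈⁻     : ∀ {s} w → s ∈ order w → s ∈ w
    order-cnt    : ∀ w x → cnt (order w) x ≡ cnt w x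
    order-length : ∀ w → length (order w) ≡ length w

cnt-reverse : ∀ xs x → cnt (reverse xs) x ≡ cnt xs x
cnt-reverse []                  x = refl
cnt-reverse ((a , b , c) ∷ xs) x = begin
    cnt (reverse ((a , b , c) ∷ xs)) x   ≡⟨ cong (λ z → cnt z x) (unfold-reverse (a , b , c) xs) ⟩
    cnt (reverse xs ++ [ (a , b , c) ]) x ≡⟨ cnt-++ (reverse xs) _ x ⟩
    cnt (reverse xs) x + (δ a x + 0)     ≡⟨ cong₂ _+_ (cnt-reverse xs x) (+-identityʳ _) ⟩
    cnt xs x + δ a x                     ≡⟨ +-comm (cnt xs x) (δ a x) ⟩
    δ a x + cnt xs x                     ∎
  where open ≡-Reasoning

misraMiwaOrder : ReadingOrder
misraMiwaOrder = record
  { order        = reverse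
  ; order-mark   = λ Q w → sym (reverse-map (mark Q) w)
  ; order-∈⁻     = λ w m → AnyP.reverse⁻ m
  ; order-cnt    = cnt-reverse
  ; order-length = length-reverse
  }

-- insertion sort by ladder position only compares positions, not signs
module LadderSort (ℓ : ℕ) where

  insert-mark : ∀ Q s ts → insert ℓ (mark Q s) (map (mark Q) ts) ≡ map (mark Q) (insert ℓ s ts)
  insert-mark Q s [] = refl
  insert-mark Q (x , y , c) ((x' , y' , c') ∷ ts) with before ℓ (x , y , c) (x' , y' , c')
  ... | true  = refl
  ... | false = cong (mark Q (x' , y' , c') ∷_) (insert-mark Q (x , y , c) ts)

  sort-mark : ∀ Q w → sortLadder ℓ (map (mark Q) w) ≡ map (mark Q) (sortLadder ℓ w)
  sort-mark Q []      = refl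
  sort-mark Q (s ∷ w) = trans (cong (insert ℓ (mark Q s)) (sort-mark Q w)) (insert-mark Q s (sortLadder ℓ w))

  insert-∈⁻ : ∀ {z} s ts → z ∈ insert ℓ s ts → z ∈ s ∷ ts
  insert-∈⁻ s [] m = m
  insert-∈⁻ s (t ∷ ts) m with before ℓ s t
  ... | true = m
  ... | false with m
  ...   | here e = there (here e)
  ...   | there m' with insert-∈⁻ s ts m'
  ...     | here e    = here e
  ...     | there m'' = there (there m'')

  sort-∈⁻ : ∀ {z} w → z ∈ sortLadder ℓ w → z ∈ w
  sort-∈⁻ []      m = m
  sort-∈⁻ (s ∷ w) m with insert-∈⁻ s (sortLadder ℓ w) m
  ... | here e   = here e
  ... | there m' = there (sort-∈⁻ w m')

  insert-cnt : ∀ s ts x → cnt (insert ℓ s ts) x ≡ cnt (s ∷ ts) x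
  insert-cnt s [] x = refl
  insert-cnt (a , b , c) ((a' , b' , c') ∷ ts) x with before ℓ (a , b , c) (a' , b' , c')
  ... | true  = refl
  ... | false = trans (cong (δ a' x +_) (insert-cnt (a , b , c) ts x)) (swap (δ a' x) (δ a x) (cnt ts x))
    where
      swap : ∀ u v w → u + (v + w) ≡ v + (u + w)
      swap = solve-∀

  sort-cnt : ∀ w x → cnt (sortLadder ℓ w) x ≡ cnt w x
  sort-cnt []                  x = refl
  sort-cnt ((a , b , c) ∷ w) x = trans (insert-cnt (a , b , c) (sortLadder ℓ w) x) (cong (δ a x +_) (sort-cnt w x))

  insert-length : ∀ s ts → length (insert ℓ s ts) ≡ suc (length ts)
  insert-length s [] = refl
  insert-length s (t ∷ ts) with before ℓ s t
  ... | true  = refl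
  ... | false = cong suc (insert-length s ts)

  sort-length : ∀ w → length (sortLadder ℓ w) ≡ length w
  sort-length []      = refl
  sort-length (s ∷ w) = trans (insert-length s (sortLadder ℓ w)) (cong suc (sort-length w))

ladderOrder : ℕ → ReadingOrder
ladderOrder ℓ = record
  { order        = sortLadder ℓ
  ; order-mark   = sort-mark
  ; order-∈⁻     = sort-∈⁻
  ; order-cnt    = sort-cnt
  ; order-length = sort-length
  }
  where open LadderSort ℓ

-- A signature + ⋯ + − ⋯ − contains no adjacent pair − +, so it is already
-- reduced; its rightmost plus is its last plus.
cancelStep-minus : ∀ M → AllMinus M → cancelStep M ≡ M
cancelStep-minus []      _ = refl
cancelStep-minus (a ∷ []) _ = refl
cancelStep-minus ((x , y , .minus) ∷ (x' , y' , .minus) ∷ r) (refl ∷ refl ∷ am) =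
  cong ((x , y , minus) ∷_) (cancelStep-minus ((x' , y' , minus) ∷ r) (refl ∷ am))

cancelStep-plus-minus : ∀ P M → AllPlus P → AllMinus M → cancelStep (P ++ M) ≡ P ++ M
cancelStep-plus-minus []                  M _          am = cancelStep-minus M am
cancelStep-plus-minus ((x , y , .plus) ∷ P) M (refl ∷ ap) am with P ++ M | cancelStep-plus-minus P M ap am
... | []    | _ = refl
... | b ∷ r | e = cong ((x , y , plus) ∷_) e

iterCancel-fixed : ∀ n w → cancelStep w ≡ w → iterCancel n w ≡ w
iterCancel-fixed zero    w e = refl
iterCancel-fixed (suc n) w e rewrite e = iterCancel-fixed n w e

reduced-plus-minus : ∀ P M → AllPlus P → AllMinus M → reduced (P ++ M) ≡ P ++ M
reduced-plus-minus P M ap am = iterCancel-fixed (length (P ++ M)) (P ++ M) (cancelStep-plus-minus P M ap am)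

rightmostPlus-minus : ∀ M → AllMinus M → rightmostPlus M ≡ nothing
rightmostPlus-minus []                    _           = refl
rightmostPlus-minus ((x , y , .minus) ∷ M) (refl ∷ am) rewrite rightmostPlus-minus M am = refl

rightmostPlus-last : ∀ P x y M → AllMinus M → rightmostPlus (P ++ (x , y , plus) ∷ M) ≡ just x
rightmostPlus-last []                x y M am rewrite rightmostPlus-minus M am = refl
rightmostPlus-last ((_ , _ , _) ∷ P) x y M am rewrite rightmostPlus-last P x y M am = refl

fOp-just : ∀ sig p r → rightmostPlus (reduced (sig p)) ≡ just r → fOp sig p ≡ just (addBox r p)
fOp-just sig p r e with rightmostPlus (reduced (sig p))
fOp-just sig p r refl | just .r = refl

fOp-nothing : ∀ sig p → rightmostPlus (reduced (sig p)) ≡ nothing → fOp sig p ≡ nothing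
fOp-nothing sig p e with rightmostPlus (reduced (sig p))
fOp-nothing sig p refl | nothing = refl

iter-beyond : ∀ f p n q → iter f n p ≡ just q → f q ≡ nothing → ∀ m → n < m → iter f m p ≡ nothing
iter-beyond f p n q e fq (suc m) (s≤s n≤m) with m≤n⇒m<n∨m≡n n≤m
... | inj₂ refl rewrite e = fq
... | inj₁ n<m  rewrite iter-beyond f p n q e fq m n<m = refl

isMaxIter-stop : ∀ f p n q → iter f n p ≡ just q → f q ≡ nothing → IsMaxIter f p n
isMaxIter-stop f p n q e fq =
  (λ e' → just≢nothing (trans (sym e) e')) ,
  (λ m ne → ≮⇒≥ (λ n<m → ne (iter-beyond f p n q e fq m n<m)))
  where
    just≢nothing : ∀ {A : Set} {a : A} → just a ≢ nothing
    just≢nothing ()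

iter-InLadd : ∀ ℓ .{{_ : NonZero ℓ}} (i : Fin ℓ) n q p → InLadd ℓ q → iter (fLad ℓ i) n q ≡ just p → InLadd ℓ p
iter-InLadd ℓ i zero    q p iq refl = iq
iter-InLadd ℓ i (suc n) q p iq e with iter (fLad ℓ i) n q in eq
... | just r  = step i (iter-InLadd ℓ i n q r iq eq) e

-- marking a sorted all-plus list keeps it sorted: a plus at row x gets key
-- 2x or 2x+1, both below the key 2x' of any later row x' > x
mark-key≤ : ∀ Q x y → key (mark Q (x , y , plus)) ≤ suc (x + x)
mark-key≤ Q x y with cnt Q x
... | zero  = n≤1+n _
... | suc _ = ≤-refl

mark-key≥ : ∀ Q x y → x + x ≤ key (mark Q (x , y , plus))
mark-key≥ Q x y with cnt Q x
... | zero  = ≤-refl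
... | suc _ = n≤1+n _

mark-keySorted : ∀ Q w → KeySorted w → AllPlus w → KeySorted (map (mark Q) w)
mark-keySorted Q []      _        _          = []
mark-keySorted Q (s ∷ w) (h ∷ ks) (ps ∷ ap) = below s w ps h ap ∷ mark-keySorted Q w ks ap
  where
    double< : ∀ x x' → x < x' → suc (x + x) < x' + x'
    double< x x' lt = ≤-trans (≤-reflexive (cong suc (sym (+-suc x x)))) (+-mono-≤ lt lt)
    below : ∀ s w → sgn s ≡ plus → All (λ t → key s < key t) w → AllPlus w →
      All (λ t → key (mark Q s) < key t) (map (mark Q) w)
    below s [] _ _ _ = []
    below (x , y , .plus) ((x' , y' , .plus) ∷ w) refl (h ∷ hs) (refl ∷ ap) =
      <-≤-trans (≤-<-trans (mark-key≤ Q x y) (double< x x' (key<⇒row< plus x x' y y' h))) (mark-key≥ Q x' y')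
      ∷ below (x , y , plus) w refl hs ap

mark-own : ∀ Q → AllMinus (map (mark Q) Q)
mark-own Q = go Q (λ m → m)
  where
    go : ∀ w → (∀ {s} → s ∈ w → s ∈ Q) → AllMinus (map (mark Q) w)
    go []      _   = []
    go (s ∷ w) sub = mark-marked Q s (cnt-∈ Q (sub (here refl))) ∷ go w (λ m → sub (there m))

unmixed⇒one-signed : ∀ w → (∀ {s t} → s ∈ w → t ∈ w → sgn s ≡ plus → sgn t ≡ minus → ⊥) →
  AllPlus w ⊎ AllMinus w
unmixed⇒one-signed []                    _  = inj₁ []
unmixed⇒one-signed ((x , y , plus) ∷ [])  _  = inj₁ (refl ∷ [])
unmixed⇒one-signed ((x , y , minus) ∷ []) _  = inj₂ (refl ∷ [])
unmixed⇒one-signed ((x , y , σ) ∷ t ∷ w) mx with unmixed⇒one-signed (t ∷ w) (λ m₁ m₂ → mx (there m₁) (there m₂))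
unmixed⇒one-signed ((x , y , plus)  ∷ t ∷ w) mx | inj₁ ap       = inj₁ (refl ∷ ap)
unmixed⇒one-signed ((x , y , plus)  ∷ t ∷ w) mx | inj₂ (h ∷ am) = ⊥-elim (mx (here refl) (there (here refl)) refl h)
unmixed⇒one-signed ((x , y , minus) ∷ t ∷ w) mx | inj₁ (h ∷ ap) = ⊥-elim (mx (there (here refl)) (here refl) h refl)
unmixed⇒one-signed ((x , y , minus) ∷ t ∷ w) mx | inj₂ am       = inj₂ (refl ∷ am)

addAll : List SPos → List ℕ → List ℕ
addAll []      p = p
addAll (e ∷ Q) p = addBox (row e) (addAll Q p)

remAll : List SPos → List ℕ → List ℕ
remAll []      p = p
remAll (e ∷ Q) p = removeBox (row e) (remAll Q p)

module ISignature (k : ℕ) (k≥1 : 1 ≤ k) (i : ℕ) where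

  open Residues k public

  sig : List ℕ → List SPos
  sig p = filterRes ℓ i (signs p)

  fOrd : ReadingOrder → List ℕ → Maybe (List ℕ)
  fOrd O = fOp (λ q → ReadingOrder.order O (sig q))

  filterRes⇒ : ∀ w x y σ → (x , y , σ) ∈ filterRes ℓ i w → (x , y , σ) ∈ w × res x y ≡ i
  filterRes⇒ ((a , b , c) ∷ w) x y σ m with residue ℓ a b ≡ᵇ i in eq
  ... | false = let (m' , r) = filterRes⇒ w x y σ m in there m' , r
  ... | true with m
  ...   | there m'  = let (m'' , r) = filterRes⇒ w x y σ m' in there m'' , r
  ...   | here refl = here refl , trans (sym (residue≡res a b)) (≡ᵇ⇒≡ _ _ (subst T (sym eq) tt))

  ⇒filterRes : ∀ w x y σ → (x , y , σ) ∈ w → res x y ≡ i → (x , y , σ) ∈ filterRes ℓ i w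
  ⇒filterRes ((a , b , c) ∷ w) x y σ m r with residue ℓ a b ≡ᵇ i in eq
  ⇒filterRes ((a , b , c) ∷ w) x y σ (here refl) r | false
    with subst T eq (≡⇒≡ᵇ _ _ (trans (residue≡res a b) r))
  ... | ()
  ⇒filterRes ((a , b , c) ∷ w) x y σ (there m)   r | false = ⇒filterRes w x y σ m r
  ⇒filterRes ((a , b , c) ∷ w) x y σ (here refl) r | true  = here refl
  ⇒filterRes ((a , b , c) ∷ w) x y σ (there m)   r | true  = there (⇒filterRes w x y σ m r)

  filterRes-sorted : ∀ w → KeySorted w → KeySorted (filterRes ℓ i w)
  filterRes-sorted []                  _        = []
  filterRes-sorted ((a , b , c) ∷ w) (h ∷ ks) with residue ℓ a b ≡ᵇ i
  ... | false = filterRes-sorted w ks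
  ... | true  = All.tabulate (λ {(x , y , σ)} m → All.lookup h (proj₁ (filterRes⇒ w x y σ m)))
                ∷ filterRes-sorted w ks

  sig-sorted : ∀ p → KeySorted (sig p)
  sig-sorted p = filterRes-sorted (signs p) (proj₁ (allSigns-sorted 1 nothing p))

  plus∈sig⇒ : ∀ p x y → Positive p → (x , y , plus) ∈ sig p →
    Addable p x × y ≡ suc (part p x) × res x y ≡ i
  plus∈sig⇒ p x y ap m with filterRes⇒ (signs p) x y plus m
  ... | m' , r = let (g , e) = plus∈signs⇒ p x y ap m' in g , e , r

  plus∈sig : ∀ p x → Addable p x → res x (suc (part p x)) ≡ i → (x , suc (part p x) , plus) ∈ sig p
  plus∈sig p x g r = ⇒filterRes (signs p) x _ plus (addable⇒plus∈signs p x g) r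

  minus∈sig⇒ : ∀ p x y → (x , y , minus) ∈ sig p → Removable p x × y ≡ part p x × res x y ≡ i
  minus∈sig⇒ p x y m with filterRes⇒ (signs p) x y minus m
  ... | m' , r = let (g , e) = minus∈signs⇒ p x y m' in g , e , r

  minus∈sig : ∀ p x → Removable p x → res x (part p x) ≡ i → (x , part p x , minus) ∈ sig p
  minus∈sig p x g r = ⇒filterRes (signs p) x _ minus (removable⇒minus∈signs p x g) r

  -- Adding any
  -- set Q of its addable i-positions (one per row) yields a diagram whose
  -- i-signature is that of p₀ with the entries of Q turned into minus signs.
  module AddAll (p₀ : List ℕ) (ap₀ : Positive p₀) (dp₀ : Decreasing p₀) (allPlus : AllPlus (sig p₀)) where

    P₀ : ℕ → ℕ
    P₀ = part p₀

    plus-entry : ∀ {e} → e ∈ sig p₀ →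
      Σ ℕ λ x → e ≡ (x , suc (P₀ x) , plus) × Addable p₀ x × res x (suc (P₀ x)) ≡ i
    plus-entry {x , y , σ} m with All.lookup allPlus m
    ... | refl with plus∈sig⇒ p₀ x y ap₀ m
    ...   | g , refl , r = x , refl , g , r

    addAll-parts : ∀ Q → All (_∈ sig p₀) Q → RowsDistinct Q →
      Positive (addAll Q p₀) × (∀ r → part (addAll Q p₀) r ≡ cnt Q r + P₀ r)
    addAll-parts []      _         _ = ap₀ , λ r → refl
    addAll-parts (e ∷ Q) (me ∷ mQ) d with plus-entry me
    ... | x , refl , g , _ = positive-addBox x _ posQ , parts
      where
        IH = addAll-parts Q mQ (RowsDistinct-tail (x , suc (P₀ x) , plus) Q d)
        posQ = proj₁ IH
        eqQ = proj₂ IH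
        still-addable : ∀ x → Addable p₀ x → cnt Q x ≡ 0 → Addable (addAll Q p₀) x
        still-addable (suc zero)    _ _ = tt
        still-addable (suc (suc z)) g c rewrite eqQ (suc (suc z)) | eqQ (suc z) | c = <-≤-trans g (m≤n+m _ _)
        parts : ∀ r → part (addBox x (addAll Q p₀)) r ≡ (δ x r + cnt Q r) + P₀ r
        parts r = begin
          part (addBox x (addAll Q p₀)) r  ≡⟨ part-addBox x _ r (still-addable x g (RowsDistinct-head x (suc (P₀ x)) plus Q d)) ⟩
          δ x r + part (addAll Q p₀) r     ≡⟨ cong (δ x r +_) (eqQ r) ⟩
          δ x r + (cnt Q r + P₀ r)         ≡⟨ sym (+-assoc (δ x r) (cnt Q r) (P₀ r)) ⟩
          (δ x r + cnt Q r) + P₀ r         ∎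
          where open ≡-Reasoning

    module Added (Q : List SPos) (mQ : All (_∈ sig p₀) Q) (dQ : RowsDistinct Q) where

      p' : List ℕ
      p' = addAll Q p₀

      P' : ℕ → ℕ
      P' = part p'

      posQ : Positive p'
      posQ = proj₁ (addAll-parts Q mQ dQ)

      eqQ : ∀ r → P' r ≡ cnt Q r + P₀ r
      eqQ = proj₂ (addAll-parts Q mQ dQ)

      unmarked-row : ∀ x → cnt Q x ≡ 0 → P' x ≡ P₀ x
      unmarked-row x c = trans (eqQ x) (cong (_+ P₀ x) c)

      marked-row : ∀ x → cnt Q x ≡ 1 → P' x ≡ suc (P₀ x)
      marked-row x c = trans (eqQ x) (cong (_+ P₀ x) c)

      marked-entry : ∀ x → cnt Q x ≡ 1 →
        res x (suc (P₀ x)) ≡ i × Addable p₀ x × (x , suc (P₀ x) , plus) ∈ sig p₀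
      marked-entry x c with cnt-witness Q x (≤-reflexive (sym c))
      ... | s , m , refl with plus-entry (All.lookup mQ m)
      ...   | x' , refl , g , r = r , g , All.lookup mQ m

      addable-before : ∀ x → cnt Q x ≡ 0 → Addable p' x → res x (suc (P' x)) ≡ i → Addable p₀ x
      addable-before (suc zero)    _ _ _ = tt
      addable-before (suc (suc z)) c g r with cnt≤1 Q (suc z) (dQ (suc z))
      ... | inj₁ c0 = subst₂ _<_ (unmarked-row _ c) (unmarked-row _ c0) g
      ... | inj₂ c1 with m≤n⇒m<n∨m≡n (≤-pred (subst₂ _<_ (unmarked-row _ c) (marked-row _ c1) g))
      ...   | inj₁ lt = lt
      ...   | inj₂ eq = ⊥-elim (lower-neighbour-res k≥1 (suc z) (suc (P₀ (suc z)))
                          (trans (proj₁ (marked-entry (suc z) c1))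
                            (sym (subst (λ w → res (suc (suc z)) (suc w) ≡ i) (trans (unmarked-row _ c) eq) r))))

      plus∈sig' : ∀ x y → (x , y , plus) ∈ sig p' → (x , y , plus) ∈ map (mark Q) (sig p₀)
      plus∈sig' x y m with plus∈sig⇒ p' x y posQ m
      ... | g' , refl , r with cnt≤1 Q x (dQ x)
      ...   | inj₂ c1 = ⊥-elim (right-neighbour-res k≥1 x (suc (P₀ x))
                          (trans (proj₁ (marked-entry x c1))
                            (sym (subst (λ w → res x (suc w) ≡ i) (marked-row x c1) r))))
      ...   | inj₁ c0 = subst (_∈ map (mark Q) (sig p₀)) same
                          (∈-map⁺ (mark Q) (plus∈sig p₀ x (addable-before x c0 g' r) r₀))
        where
          r₀ : res x (suc (P₀ x)) ≡ i
          r₀ = subst (λ w → res x (suc w) ≡ i) (unmarked-row x c0) r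
          same : mark Q (x , suc (P₀ x) , plus) ≡ (x , suc (P' x) , plus)
          same rewrite c0 | unmarked-row x c0 = refl

      minus∈sig' : ∀ x y → (x , y , minus) ∈ sig p' → (x , y , minus) ∈ map (mark Q) (sig p₀)
      minus∈sig' x y m with minus∈sig⇒ p' x y m
      ... | rm , refl , r with cnt≤1 Q x (dQ x)
      ...   | inj₂ c1 = subst (_∈ map (mark Q) (sig p₀)) same (∈-map⁺ (mark Q) (proj₂ (proj₂ (marked-entry x c1))))
        where
          same : mark Q (x , suc (P₀ x) , plus) ≡ (x , P' x , minus)
          same rewrite c1 | eqQ x | c1 = refl
      ...   | inj₁ c0 with All.lookup allPlus (minus∈sig p₀ x rm₀ r₀)
        where
          r₀ : res x (P₀ x) ≡ i
          r₀ = subst (λ w → res x w ≡ i) (unmarked-row x c0) r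
          rm₀ : Removable p₀ x
          rm₀ = <-≤-trans (≤-<-trans (m≤n+m _ _) (subst (_< P' x) (eqQ (suc x)) rm)) (≤-reflexive (unmarked-row x c0))
      ...     | ()

      marked∈sig' : ∀ x → cnt Q x ≡ 1 → (x , suc (P₀ x) , plus) ∈ sig p₀ → mark Q (x , suc (P₀ x) , plus) ∈ sig p'
      marked∈sig' x c1 m = subst (_∈ sig p') same (minus∈sig p' x rm r')
        where
          r' : res x (P' x) ≡ i
          r' = subst (λ w → res x w ≡ i) (sym (marked-row x c1)) (proj₁ (marked-entry x c1))
          below : ∀ x → Addable p₀ x → P' (suc x) < suc (P₀ x)
          below (suc w) g with cnt≤1 Q (suc (suc w)) (dQ (suc (suc w)))
          ... | inj₁ c0' = s≤s (subst (_≤ P₀ (suc w)) (sym (unmarked-row _ c0')) (dp₀ w))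
          ... | inj₂ c1' = s≤s (subst (_≤ P₀ (suc w)) (sym (marked-row _ c1')) (proj₁ (proj₂ (marked-entry (suc (suc w)) c1'))))
          rm : Removable p' x
          rm = subst (P' (suc x) <_) (sym (marked-row x c1)) (below x (proj₁ (proj₂ (marked-entry x c1))))
          same : (x , P' x , minus) ≡ mark Q (x , suc (P₀ x) , plus)
          same rewrite c1 | marked-row x c1 = refl

      unmarked∈sig' : ∀ x → cnt Q x ≡ 0 → Addable p₀ x → res x (suc (P₀ x)) ≡ i → mark Q (x , suc (P₀ x) , plus) ∈ sig p'
      unmarked∈sig' x c0 g r = subst (_∈ sig p') same (plus∈sig p' x (still-addable x c0 g) r')
        where
          r' : res x (suc (P' x)) ≡ i
          r' = subst (λ w → res x (suc w) ≡ i) (sym (unmarked-row x c0)) r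
          still-addable : ∀ x → cnt Q x ≡ 0 → Addable p₀ x → Addable p' x
          still-addable (suc zero)    _ _ = tt
          still-addable (suc (suc w)) c g =
            subst (_< P' (suc w)) (sym (unmarked-row _ c)) (<-≤-trans g (subst (P₀ (suc w) ≤_) (sym (eqQ (suc w))) (m≤n+m _ _)))
          same : (x , suc (P' x) , plus) ≡ mark Q (x , suc (P₀ x) , plus)
          same rewrite c0 | unmarked-row x c0 = refl

      sig-addAll : sig p' ≡ map (mark Q) (sig p₀)
      sig-addAll = keySorted-unique (sig-sorted p') (mark-keySorted Q (sig p₀) (sig-sorted p₀) allPlus) fwd bwd
        where
          fwd : ∀ {z} → z ∈ sig p' → z ∈ map (mark Q) (sig p₀)
          fwd {x , y , plus}  m = plus∈sig' x y m
          fwd {x , y , minus} m = minus∈sig' x y m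
          bwd : ∀ {z} → z ∈ map (mark Q) (sig p₀) → z ∈ sig p'
          bwd m with ∈-map⁻ (mark Q) m
          ... | t , mt , refl with plus-entry mt
          ...   | x , refl , g , r with cnt≤1 Q x (dQ x)
          ...     | inj₂ c1 = marked∈sig' x c1 mt
          ...     | inj₁ c0 = unmarked∈sig' x c0 g r

    -- In any reading order, the operator adds the addable i-positions one
    -- by one, from the right end of the signature to the left, and then
    -- stops: φ(p₀) = #plus signs and f^φ(p₀) = p₀ + all of them.
    module AddInOrder (O : ReadingOrder) where
      open ReadingOrder O

      f : List ℕ → Maybe (List ℕ)
      f = fOrd O

      L : List SPos
      L = order (sig p₀)

      L⊆sig : All (_∈ sig p₀) L
      L⊆sig = All.tabulate (order-∈⁻ (sig p₀))

      L-distinct : RowsDistinct L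
      L-distinct x = subst (_≤ 1) (sym (order-cnt (sig p₀) x))
                       (keySorted⇒rowsDistinct plus (sig p₀) (sig-sorted p₀) allPlus x)

      L-plus : AllPlus L
      L-plus = All.map (All.lookup allPlus) L⊆sig

      ordered-sig-addAll : ∀ Q → All (_∈ sig p₀) Q → RowsDistinct Q → order (sig (addAll Q p₀)) ≡ map (mark Q) L
      ordered-sig-addAll Q mQ dQ = trans (cong order (Added.sig-addAll Q mQ dQ)) (order-mark Q (sig p₀))

      step-suffix : ∀ P e Q → L ≡ P ++ e ∷ Q → f (addAll Q p₀) ≡ just (addAll (e ∷ Q) p₀)
      step-suffix P e Q L≡ = fOp-just (λ q → order (sig q)) (addAll Q p₀) (row e) rightmost
        where
          Pe = P ++ [ e ]
          L≡' : L ≡ Pe ++ Q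
          L≡' = trans L≡ (sym (++-assoc P [ e ] Q))
          cnt-split : ∀ x → cnt Pe x + cnt Q x ≤ 1
          cnt-split x = subst (_≤ 1) (trans (cong (λ w → cnt w x) L≡') (cnt-++ Pe Q x)) (L-distinct x)
          Q⊆sig : All (_∈ sig p₀) Q
          Q⊆sig = AllP.++⁻ʳ Pe (subst (All (_∈ sig p₀)) L≡' L⊆sig)
          Q-distinct : RowsDistinct Q
          Q-distinct x = ≤-trans (m≤n+m (cnt Q x) (cnt Pe x)) (cnt-split x)
          Pe-unmarked : All (λ s → mark Q s ≡ s) Pe
          Pe-unmarked = All.tabulate (λ {s} m → mark-unmarked Q s
            (n≤0⇒n≡0 (≤-pred (≤-trans (+-monoˡ-≤ (cnt Q (row s)) (cnt-∈ Pe m)) (cnt-split (row s))))))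
          Pe-plus : AllPlus Pe
          Pe-plus = AllP.++⁻ˡ Pe (subst AllPlus L≡' L-plus)
          sig≡ : order (sig (addAll Q p₀)) ≡ Pe ++ map (mark Q) Q
          sig≡ = begin
            order (sig (addAll Q p₀))        ≡⟨ ordered-sig-addAll Q Q⊆sig Q-distinct ⟩
            map (mark Q) L                   ≡⟨ cong (map (mark Q)) L≡' ⟩
            map (mark Q) (Pe ++ Q)           ≡⟨ map-++ (mark Q) Pe Q ⟩
            map (mark Q) Pe ++ map (mark Q) Q ≡⟨ cong (_++ map (mark Q) Q) (map-id-local Pe-unmarked) ⟩
            Pe ++ map (mark Q) Q             ∎
            where open ≡-Reasoning
          last-plus : ∀ e → sgn e ≡ plus → rightmostPlus (P ++ e ∷ map (mark Q) Q) ≡ just (row e)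
          last-plus (x , y , .plus) refl = rightmostPlus-last P x y (map (mark Q) Q) (mark-own Q)
          rightmost : rightmostPlus (reduced (order (sig (addAll Q p₀)))) ≡ just (row e)
          rightmost rewrite sig≡ | reduced-plus-minus Pe (map (mark Q) Q) Pe-plus (mark-own Q)
                          | ++-assoc P [ e ] (map (mark Q) Q) =
            last-plus e (All.lookup Pe-plus (∈-++⁺ʳ P (here refl)))

      add-suffix : ∀ Q P → L ≡ P ++ Q → iter f (length Q) p₀ ≡ just (addAll Q p₀)
      add-suffix []      P L≡ = refl
      add-suffix (e ∷ Q) P L≡ =
        trans (cong (_>>= f) (add-suffix Q (P ++ [ e ]) (trans L≡ (sym (++-assoc P [ e ] Q)))))
              (step-suffix P e Q L≡)

      add-all : iter f (length (sig p₀)) p₀ ≡ just (addAll L p₀)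
      add-all = subst (λ n → iter f n p₀ ≡ just (addAll L p₀)) (order-length (sig p₀)) (add-suffix L [] refl)

      stops : f (addAll L p₀) ≡ nothing
      stops = fOp-nothing (λ q → order (sig q)) (addAll L p₀) none
        where
          none : rightmostPlus (reduced (order (sig (addAll L p₀)))) ≡ nothing
          none rewrite ordered-sig-addAll L L⊆sig L-distinct | reduced-plus-minus [] (map (mark L) L) [] (mark-own L) =
            rightmostPlus-minus _ (mark-own L)

      φ≡ : IsMaxIter f p₀ (length (sig p₀))
      φ≡ = isMaxIter-stop f p₀ _ _ add-all stops

      -- the result only depends on how many boxes were added in each row
      parts-after : ∀ r → part (addAll L p₀) r ≡ cnt (sig p₀) r + P₀ r
      parts-after r = trans (proj₂ (addAll-parts L L⊆sig L-distinct) r) (cong (_+ P₀ r) (order-cnt (sig p₀) r))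

      positive-after : Positive (addAll L p₀)
      positive-after = proj₁ (addAll-parts L L⊆sig L-distinct)

    addAll-order-free : ∀ O O' → iter (fOrd O) (length (sig p₀)) p₀ ≡ iter (fOrd O') (length (sig p₀)) p₀
    addAll-order-free O O' = trans A.add-all (trans (cong just same) (sym B.add-all))
      where
        module A = AddInOrder O
        module B = AddInOrder O'
        same : addAll A.L p₀ ≡ addAll B.L p₀
        same = part-ext _ _ A.positive-after B.positive-after (λ r → trans (A.parts-after r) (sym (B.parts-after r)))

  -- An ℓ-core has no addable i-position and removable i-box at the same
  -- time: in the same row they would be adjacent; otherwise the box in the
  -- upper row and the column of the lower one has a hook divisible by ℓ.
  core-unmixed : ∀ p → Positive p → Decreasing p → IsCore ℓ p →
    ∀ a b c d → (a , b , plus) ∈ sig p → (c , d , minus) ∈ sig p → ⊥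
  core-unmixed p ap dp core a b c d ma mc with plus∈sig⇒ p a b ap ma | minus∈sig⇒ p c d mc
  ... | ga , refl , ra | rc , refl , rc≡i with <-cmp a c
  ... | tri≈ _ refl _ = right-neighbour-res k≥1 a (part p a) (trans rc≡i (sym ra))
  ... | tri< a<c _ _ = core a (part p c) a≥1 (≤-<-trans z≤n rc) λc≤λa
          (hook-divisible⇐ p a (part p c) c (removable⇒colLen p c dp rc) λc≤λa (<⇒≤ a<c) (trans ra (sym rc≡i)))
    where
      a≥1 : 1 ≤ a
      a≥1 = addable⇒row≥1 p a ga
      λc≤λa : part p c ≤ part p a
      λc≤λa = part-antitone p dp a c a≥1 (<⇒≤ a<c)
  ... | tri> _ _ c<a = lower-row a c<a ga ra
    where
      c≥1 : 1 ≤ c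
      c≥1 = removable⇒row≥1 p c rc
      lower-row : ∀ a → c < a → Addable p a → res a (suc (part p a)) ≡ i → ⊥
      lower-row (suc zero)    (s≤s c≤0) _  _  = <-irrefl refl (≤-trans c≥1 c≤0)
      lower-row (suc (suc z)) c<a       ga ra =
        core c (suc (part p (suc (suc z)))) c≥1 (s≤s z≤n) λa<λc
          (hook-divisible⇐ p c (suc (part p (suc (suc z)))) (suc z) (addable⇒colLen p z dp ga) λa<λc (≤-pred c<a) same)
        where
          λa<λc : suc (part p (suc (suc z))) ≤ part p c
          λa<λc = ≤-trans ga (part-antitone p dp c (suc z) c≥1 (≤-pred c<a))
          same : res c (suc (part p c)) ≡ res (suc z) (suc (part p (suc (suc z))))
          same = trans (res-shift-right c (part p c) (suc (suc z)) (suc (part p (suc (suc z)))) (trans rc≡i (sym ra)))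
                       (res-diagonal (suc z) (suc (part p (suc (suc z)))))

  core-one-signed : ∀ p → Positive p → Decreasing p → IsCore ℓ p → AllPlus (sig p) ⊎ AllMinus (sig p)
  core-one-signed p ap dp core = unmixed⇒one-signed (sig p) mixed
    where
      mixed : ∀ {s t} → s ∈ sig p → t ∈ sig p → sgn s ≡ plus → sgn t ≡ minus → ⊥
      mixed {a , b , .plus} {c , d , .minus} ms mt refl refl = core-unmixed p ap dp core a b c d ms mt

  φ-zero : ∀ O p → AllMinus (sig p) → IsMaxIter (fOrd O) p 0
  φ-zero O p am = isMaxIter-stop (fOrd O) p 0 p refl (fOp-nothing (λ q → order (sig q)) p none)
    where
      open ReadingOrder O
      am' : AllMinus (order (sig p))
      am' = All.tabulate (λ m → All.lookup am (order-∈⁻ (sig p) m))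
      none : rightmostPlus (reduced (order (sig p))) ≡ nothing
      none rewrite reduced-plus-minus [] (order (sig p)) [] am' = rightmostPlus-minus _ am'

  φ-agree : ∀ p → Positive p → Decreasing p → IsCore ℓ p →
    Σ ℕ λ n → IsMaxIter (fOrd (ladderOrder ℓ)) p n × IsMaxIter (fOrd misraMiwaOrder) p n ×
      iter (fOrd (ladderOrder ℓ)) n p ≡ iter (fOrd misraMiwaOrder) n p
  φ-agree p ap dp core with core-one-signed p ap dp core
  ... | inj₂ am = 0 , φ-zero (ladderOrder ℓ) p am , φ-zero misraMiwaOrder p am , refl
  ... | inj₁ al = length (sig p) , Ladder.φ≡ , MisraMiwa.φ≡ , addAll-order-free (ladderOrder ℓ) misraMiwaOrder
    where
      open AddAll p ap dp al
      module Ladder    = AddInOrder (ladderOrder ℓ)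
      module MisraMiwa = AddInOrder misraMiwaOrder

  -- Removing all removable i-boxes gives a smaller diagram q, again
  -- an ℓ-core, whose i-signature has only plus signs (exactly at the removed
  -- boxes); so the ladder operator applied φ(q) times to q gives back p.
  module RemoveAll (p : List ℕ) (ap : Positive p) (dp : Decreasing p) (core : IsCore ℓ p)
                   (allMinus : AllMinus (sig p)) where

    P : ℕ → ℕ
    P = part p

    -- A x = 1 if row x loses its last box, 0 otherwise
    A : ℕ → ℕ
    A x = cnt (sig p) x

    A-distinct : RowsDistinct (sig p)
    A-distinct = keySorted⇒rowsDistinct minus (sig p) (sig-sorted p) allMinus

    A-01 : ∀ x → A x ≡ 0 ⊎ A x ≡ 1
    A-01 x = cnt≤1 (sig p) x (A-distinct x)

    minus-entry : ∀ {e} → e ∈ sig p → Σ ℕ λ x → e ≡ (x , P x , minus) × Removable p x × res x (P x) ≡ i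
    minus-entry {x , y , σ} m with All.lookup allMinus m
    ... | refl with minus∈sig⇒ p x y m
    ...   | g , refl , r = x , refl , g , r

    shortened⇒removable : ∀ x → A x ≡ 1 → Removable p x × res x (P x) ≡ i
    shortened⇒removable x c with cnt-witness (sig p) x (≤-reflexive (sym c))
    ... | s , m , refl with minus-entry m
    ...   | x' , refl , g , r = g , r

    removable⇒shortened : ∀ x → Removable p x → res x (P x) ≡ i → A x ≡ 1
    removable⇒shortened x g r = ≤-antisym (A-distinct x) (cnt-∈ (sig p) (minus∈sig p x g r))

    unshortened-not-removable : ∀ x → A x ≡ 0 → Removable p x → res x (P x) ≡ i → ⊥
    unshortened-not-removable x e0 g r with trans (sym e0) (removable⇒shortened x g r)
    ... | ()

    no-addable : ∀ x → Addable p x → res x (suc (P x)) ≡ i → ⊥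
    no-addable x g r with All.lookup allMinus (plus∈sig p x g r)
    ... | ()

    remAll-parts : ∀ Q → All (_∈ sig p) Q → RowsDistinct Q →
      Positive (remAll Q p) × (∀ r → part (remAll Q p) r ≡ P r ∸ cnt Q r) × (sum (remAll Q p) + length Q ≡ sum p)
    remAll-parts []      _         _ = ap , (λ r → refl) , +-identityʳ _
    remAll-parts (e ∷ Q) (me ∷ mQ) d with minus-entry me
    ... | x , refl , g , _ = positive-removeBox x _ posQ , parts , size
      where
        IH = remAll-parts Q mQ (RowsDistinct-tail (x , P x , minus) Q d)
        posQ = proj₁ IH
        eqQ = proj₁ (proj₂ IH)
        c0 : cnt Q x ≡ 0
        c0 = RowsDistinct-head x (P x) minus Q d
        rmQ : Removable (remAll Q p) x
        rmQ = subst₂ _<_ (sym (eqQ (suc x))) (sym (trans (eqQ x) (cong (P x ∸_) c0)))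
                (≤-<-trans (m∸n≤m (P (suc x)) (cnt Q (suc x))) g)
        parts : ∀ r → part (removeBox x (remAll Q p)) r ≡ P r ∸ (δ x r + cnt Q r)
        parts r = begin
          part (removeBox x (remAll Q p)) r ≡⟨ part-removeBox x (remAll Q p) r posQ rmQ ⟩
          part (remAll Q p) r ∸ δ x r       ≡⟨ cong (_∸ δ x r) (eqQ r) ⟩
          P r ∸ cnt Q r ∸ δ x r             ≡⟨ ∸-+-assoc (P r) (cnt Q r) (δ x r) ⟩
          P r ∸ (cnt Q r + δ x r)           ≡⟨ cong (P r ∸_) (+-comm (cnt Q r) (δ x r)) ⟩
          P r ∸ (δ x r + cnt Q r)           ∎
          where open ≡-Reasoning
        size : sum (removeBox x (remAll Q p)) + suc (length Q) ≡ sum p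
        size = trans (+-suc _ _) (trans (cong (_+ length Q) (sum-removeBox x (remAll Q p) posQ rmQ)) (proj₂ (proj₂ IH)))

    q : List ℕ
    q = remAll (sig p) p

    removed : Positive q × (∀ r → part q r ≡ P r ∸ A r) × (sum q + length (sig p) ≡ sum p)
    removed = remAll-parts (sig p) (All.tabulate (λ m → m)) A-distinct

    Pq : ℕ → ℕ
    Pq = part q

    unchanged-row : ∀ x → A x ≡ 0 → Pq x ≡ P x
    unchanged-row x e = trans (proj₁ (proj₂ removed) x) (cong (P x ∸_) e)

    shortened-row : ∀ x → A x ≡ 1 → Σ ℕ λ j → P x ≡ suc j × Pq x ≡ j
    shortened-row x e with shortened⇒removable x e
    ... | g , _ with P x | proj₁ (proj₂ removed) x | g
    ...   | suc j | eq | _ = j , refl , trans eq (cong (suc j ∸_) e)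

    Pq≤P : ∀ x → Pq x ≤ P x
    Pq≤P x = subst (_≤ P x) (sym (proj₁ (proj₂ removed) x)) (m∸n≤m (P x) (A x))

    P-step : ∀ x → 1 ≤ x → P (suc x) ≤ P x
    P-step (suc w) _ = dp w

    q-decreasing : Decreasing q
    q-decreasing r with A-01 (suc r) | A-01 (suc (suc r))
    ... | inj₁ e₁ | inj₁ e₂ rewrite unchanged-row _ e₁ | unchanged-row _ e₂ = dp r
    ... | inj₁ e₁ | inj₂ e₂ with shortened-row _ e₂
    ...   | j , pj , qj rewrite unchanged-row _ e₁ | qj = ≤-trans (n≤1+n j) (subst (_≤ P (suc r)) pj (dp r))
    q-decreasing r | inj₂ e₁ | inj₁ e₂ with shortened-row _ e₁ | shortened⇒removable _ e₁
    ...   | j , pj , qj | g , _ rewrite unchanged-row _ e₂ | qj = ≤-pred (subst (P (suc (suc r)) <_) pj g)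
    q-decreasing r | inj₂ e₁ | inj₂ e₂ with shortened-row _ e₁ | shortened-row _ e₂ | shortened⇒removable _ e₁
    ...   | j , pj , qj | j' , pj' , qj' | g , _ rewrite qj | qj' = <⇒≤ (≤-pred (subst₂ _<_ pj' pj g))

    -- q has no removable i-box: it would be next to a removed box, or be
    -- removable already in p
    q-no-minus : ∀ x y → (x , y , minus) ∈ sig q → ⊥
    q-no-minus x y m with minus∈sig⇒ q x y m
    ... | rm , refl , r with A-01 x
    ...   | inj₂ e₁ with shortened-row x e₁ | shortened⇒removable x e₁
    ...     | j , pj , qj | _ , rx = right-neighbour-res k≥1 x j
                                       (trans (subst (λ w → res x w ≡ i) qj r) (sym (subst (λ w → res x w ≡ i) pj rx)))
    q-no-minus x y m | rm , refl , r | inj₁ e₀ with A-01 (suc x)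
    ...   | inj₁ e₀' = unshortened-not-removable x e₀
                         (subst₂ _<_ (unchanged-row (suc x) e₀') (unchanged-row x e₀) rm) r₀
      where
        r₀ : res x (P x) ≡ i
        r₀ = subst (λ w → res x w ≡ i) (unchanged-row x e₀) r
    ...   | inj₂ e₁' with shortened⇒removable (suc x) e₁' | m≤n⇒m<n∨m≡n (P-step x (removable⇒row≥1 q x rm))
    ...     | _ , rsx | inj₁ lt  = unshortened-not-removable x e₀ lt (subst (λ w → res x w ≡ i) (unchanged-row x e₀) r)
    ...     | _ , rsx | inj₂ eqp = lower-neighbour-res k≥1 x (P x)
                                     (trans (subst (λ w → res x w ≡ i) (unchanged-row x e₀) r)
                                            (sym (subst (λ w → res (suc x) w ≡ i) eqp rsx)))

    q-all-plus : AllPlus (sig q)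
    q-all-plus = All.tabulate λ { {(x , y , plus)} m → refl ; {(x , y , minus)} m → ⊥-elim (q-no-minus x y m) }

    unshortened-addable : ∀ x → A x ≡ 0 → Addable q x → Addable p x
    unshortened-addable (suc zero)    _  _ = tt
    unshortened-addable (suc (suc z)) e₀ h = subst (_< P (suc z)) (unchanged-row _ e₀) (<-≤-trans h (Pq≤P (suc z)))

    shortened-addable : ∀ x → A x ≡ 1 → Addable q x
    shortened-addable zero e₁ = ⊥-elim (row0-not-removable p (proj₁ (shortened⇒removable 0 e₁)))
    shortened-addable (suc zero) e₁ = tt
    shortened-addable (suc (suc z)) e₁ with shortened-row _ e₁ | shortened⇒removable _ e₁ | A-01 (suc z)
    ... | j , pj , qj | _ , rx | inj₁ e₀ =
      subst₂ _<_ (sym qj) (sym (unchanged-row _ e₀)) (<-≤-trans (n<1+n j) (subst (_≤ P (suc z)) pj (dp z)))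
    ... | j , pj , qj | _ , rx | inj₂ e₁' with shortened-row _ e₁' | shortened⇒removable _ e₁' | m≤n⇒m<n∨m≡n (dp z)
    ...   | j' , pj' , qj' | _ , rx' | inj₁ lt  = subst₂ _<_ (sym qj) (sym qj') (≤-pred (subst₂ _<_ pj pj' lt))
    ...   | j' , pj' , qj' | _ , rx' | inj₂ eqp =
      ⊥-elim (lower-neighbour-res k≥1 (suc z) (P (suc z)) (trans rx' (sym (subst (λ w → res (suc (suc z)) w ≡ i) eqp rx))))

    plus⇒shortened : ∀ x y → (x , y , plus) ∈ sig q → A x ≡ 1
    plus⇒shortened x y m with plus∈sig⇒ q x y (proj₁ removed) m
    ... | g , refl , r with A-01 x
    ...   | inj₂ e₁ = e₁
    ...   | inj₁ e₀ = ⊥-elim (no-addable x (unshortened-addable x e₀ g) (subst (λ w → res x (suc w) ≡ i) (unchanged-row x e₀) r))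

    shortened⇒plus : ∀ x → A x ≡ 1 → (x , suc (Pq x) , plus) ∈ sig q
    shortened⇒plus x e₁ with shortened-row x e₁ | shortened⇒removable x e₁
    ... | j , pj , qj | _ , rx = plus∈sig q x (shortened-addable x e₁) (subst (λ w → res x w ≡ i) (trans pj (cong suc (sym qj))) rx)

    sig-q-cnt : ∀ x → cnt (sig q) x ≡ A x
    sig-q-cnt x with cnt≤1 (sig q) x (keySorted⇒rowsDistinct plus (sig q) (sig-sorted q) q-all-plus x) | A-01 x
    ... | inj₁ c₀ | inj₁ e₀ = trans c₀ (sym e₀)
    ... | inj₂ c₁ | inj₂ e₁ = trans c₁ (sym e₁)
    ... | inj₁ c₀ | inj₂ e₁ = ⊥-elim (<-irrefl refl (subst (1 ≤_) c₀ (cnt-∈ (sig q) (shortened⇒plus x e₁))))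
    ... | inj₂ c₁ | inj₁ e₀ with cnt-witness (sig q) x (≤-reflexive (sym c₁))
    ...   | (x' , y' , σ) , m , refl with All.lookup q-all-plus m
    ...     | refl with trans (sym e₀) (plus⇒shortened x' y' m)
    ...       | ()

    -- q is again an ℓ-core.  Take a box (r , c) of q whose column in q ends
    -- in row m + 1, with ℓ dividing its hook in q; in each case we find a
    -- box of p with a hook divisible by ℓ.
    divisible-hook-in-p : ∀ r c m → 1 ≤ r → 1 ≤ c → c ≤ P r → r ≤ m → colLen p c ≡ m →
      res r (suc (P r)) ≡ res m c → ⊥
    divisible-hook-in-p r c m r≥1 c≥1 le r≤m col e = core r c r≥1 c≥1 le (hook-divisible⇐ p r c m col le r≤m e)

    column-end : ∀ x c → Pq x < c → P x < c ⊎ (A x ≡ 1 × P x ≡ c)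
    column-end x c lt with A-01 x
    ... | inj₁ e₀ = inj₁ (subst (_< c) (unchanged-row x e₀) lt)
    ... | inj₂ e₁ with shortened-row x e₁
    ...   | j , pj , qj with m≤n⇒m<n∨m≡n (subst (_< c) qj lt)
    ...     | inj₁ j<c = inj₁ (subst (_< c) (sym pj) j<c)
    ...     | inj₂ eq  = inj₂ (e₁ , trans pj eq)

    q-hook-unshortened : ∀ r c m → A r ≡ 0 → 1 ≤ r → 1 ≤ c → c ≤ P r → r ≤ suc m →
      c ≤ Pq (suc m) → Pq (suc (suc m)) < c → res r (suc (P r)) ≡ res (suc m) c → ⊥
    q-hook-unshortened r c m e₀ r≥1 c≥1 le r≤ c≤ <c E with column-end (suc (suc m)) c <c
    ... | inj₁ lt = divisible-hook-in-p r c (suc m) r≥1 c≥1 le r≤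
                      (colLen-exact p c dp c≥1 m (≤-trans c≤ (Pq≤P (suc m))) lt) E
    ... | inj₂ (e₁ , pc) with shortened⇒removable _ e₁ | m≤n⇒m<n∨m≡n (P-step r r≥1)
    ...   | rm , r≡i | inj₁ lt  = unshortened-not-removable r e₀ lt (trans same (subst (λ w → res (suc (suc m)) w ≡ i) pc r≡i))
      where
        same : res r (P r) ≡ res (suc (suc m)) c
        same = res-shift-left r (P r) (suc (suc m)) c (trans E (sym (res-diagonal (suc m) c)))
    ...   | rm , r≡i | inj₂ eqr = divisible-hook-in-p (suc r) c (suc (suc m)) (s≤s z≤n) c≥1
                                   (subst (c ≤_) (sym eqr) le) (s≤s r≤)
                                   (colLen-exact p c dp c≥1 (suc m) (≤-reflexive (sym pc)) (subst (P (suc (suc (suc m))) <_) pc rm))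
                                   (trans (subst (λ w → res (suc r) (suc w) ≡ res r (P r)) (sym eqr) (res-diagonal r (P r))) same)
      where
        same : res r (P r) ≡ res (suc (suc m)) c
        same = res-shift-left r (P r) (suc (suc m)) c (trans E (sym (res-diagonal (suc m) c)))

    q-hook-shortened : ∀ r c m → A r ≡ 1 → 1 ≤ r → 1 ≤ c → r ≤ suc m →
      c ≤ Pq (suc m) → Pq (suc (suc m)) < c → res r (P r) ≡ res (suc m) c → ⊥
    q-hook-shortened r c m e₁ r≥1 c≥1 r≤ c≤ <c E with column-end (suc (suc m)) c <c
    ... | inj₂ (e₁' , pc) = lower-neighbour-res k≥1 (suc m) c
                              (trans m≡i (sym (subst (λ w → res (suc (suc m)) w ≡ i) pc (proj₂ (shortened⇒removable _ e₁')))))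
      where
        m≡i : res (suc m) c ≡ i
        m≡i = trans (sym E) (proj₂ (shortened⇒removable r e₁))
    ... | inj₁ lt with m≤n⇒m<n∨m≡n (≤-trans c≤ (Pq≤P (suc m)))
    ...   | inj₂ c≡ with shortened-row (suc m) (removable⇒shortened (suc m) (subst (P (suc (suc m)) <_) c≡ lt) m≡i)
      where
        m≡i : res (suc m) (P (suc m)) ≡ i
        m≡i = subst (λ w → res (suc m) w ≡ i) c≡ (trans (sym E) (proj₂ (shortened⇒removable r e₁)))
    ...     | j' , pj' , qj' = <-irrefl refl (subst (_≤ j') (trans c≡ pj') (subst (c ≤_) qj' c≤))
    q-hook-shortened r c m e₁ r≥1 c≥1 r≤ c≤ <c E | inj₁ lt | inj₁ c<
      = divisible-hook-in-p r (suc c) (suc m) r≥1 (s≤s z≤n) (≤-trans c< (part-antitone p dp r (suc m) r≥1 r≤)) r≤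
          (colLen-exact p (suc c) dp (s≤s z≤n) m c< (≤-trans lt (n≤1+n c)))
          (res-shift-right r (P r) (suc m) c E)

    q-core : IsCore ℓ q
    q-core r c r≥1 c≥1 le dv with colLen-box q c q-decreasing c≥1 r r≥1 le
    ... | m , col , r≤ , c≤ , <c with hook-divisible⇒ q r c (suc m) col le r≤ dv | A-01 r
    ...   | E | inj₁ e₀ = q-hook-unshortened r c m e₀ r≥1 c≥1 (subst (c ≤_) (unchanged-row r e₀) le) r≤ c≤ <c
                            (subst (λ w → res r (suc w) ≡ res (suc m) c) (unchanged-row r e₀) E)
    ...   | E | inj₂ e₁ with shortened-row r e₁
    ...     | j , pj , qj = q-hook-shortened r c m e₁ r≥1 c≥1 r≤ c≤ <c
                              (subst (λ w → res r w ≡ res (suc m) c) (trans (cong suc qj) (sym pj)) E)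

    ladder-restores : iter (fOrd (ladderOrder ℓ)) (length (sig q)) q ≡ just p
    ladder-restores = trans Q.add-all (cong just (part-ext _ _ Q.positive-after ap parts))
      where
        module Q = AddAll.AddInOrder q (proj₁ removed) q-decreasing q-all-plus (ladderOrder ℓ)
        A≤P : ∀ r → A r ≤ P r
        A≤P r with A-01 r
        ... | inj₁ e₀ = subst (_≤ P r) (sym e₀) z≤n
        ... | inj₂ e₁ with shortened-row r e₁
        ...   | j , pj , _ = subst₂ _≤_ (sym e₁) (sym pj) (s≤s z≤n)
        parts : ∀ r → part (addAll Q.L q) r ≡ P r
        parts r = trans (Q.parts-after r) (trans (cong₂ _+_ (sig-q-cnt r) (proj₁ (proj₂ removed) r)) (m+[n∸m]≡n (A≤P r)))

    q-smaller : ∀ {e} → e ∈ sig p → sum q < sum p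
    q-smaller {e} m = subst (sum q <_) (proj₂ (proj₂ removed)) (m<m+n (sum q) (nonempty (sig p) m))
      where
        nonempty : ∀ (w : List SPos) → e ∈ w → 0 < length w
        nonempty (_ ∷ _) _ = s≤s z≤n

last-row-removable : ∀ a p → Positive (a ∷ p) → Removable (a ∷ p) (length (a ∷ p))
last-row-removable a []      (h ∷ _)  = h
last-row-removable a (b ∷ p) (_ ∷ ap) = last-row-removable b p ap

-- Induction
-- on the size: let i be the residue of the last box of the last row; the
-- i-signature of the core is then all minus, and removing all its i-boxes
-- gives a smaller core from which the ladder operator f̂ᵢ rebuilds p.
core-InLadd : ∀ k → 1 ≤ k → ∀ n p → sum p < n → Positive p → Decreasing p → IsCore (suc k) p → InLadd (suc k) p
core-InLadd k k≥1 n       []      _  _  _  _    = empty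
core-InLadd k k≥1 (suc n) (a ∷ p) lt ap dp core =
  iter-InLadd (suc k) i (length (sig R.q)) R.q (a ∷ p) q∈ladd R.ladder-restores
  where
    x = length (a ∷ p)
    i : Fin (suc k)
    i = fromℕ< (m%n<n (Residues.content k x (part (a ∷ p) x)) (suc k))
    open ISignature k k≥1 (toℕ i)
    last∈sig : (x , part (a ∷ p) x , minus) ∈ sig (a ∷ p)
    last∈sig = minus∈sig (a ∷ p) x (last-row-removable a p ap) (sym (toℕ-fromℕ< _))
    allMinus : AllMinus (sig (a ∷ p))
    allMinus with core-one-signed (a ∷ p) ap dp core
    ... | inj₂ am = am
    ... | inj₁ al with All.lookup al last∈sig
    ...   | ()
    module R = RemoveAll (a ∷ p) ap dp core allMinus
    q∈ladd : InLadd (suc k) R.q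
    q∈ladd = core-InLadd k k≥1 n R.q (≤-trans (R.q-smaller last∈sig) (≤-pred lt))
               (proj₁ R.removed) R.q-decreasing R.q-core

lemma4p3 : (ℓ : ℕ) .{{_ : NonZero ℓ}} → 3 ≤ ℓ → (p : List ℕ) → IsPartition p → IsCore ℓ p →
    InLadd ℓ p ×
    (∀ (i : Fin ℓ) → ∃[ n ] (IsMaxIter (fLad ℓ i) p n × IsMaxIter (fMM ℓ i) p n ×
      iter (fLad ℓ i) n p ≡ iter (fMM ℓ i) n p))
lemma4p3 (suc k) (s≤s (s≤s _)) p (linked , ap) core =
  core-InLadd k (s≤s z≤n) (suc (sum p)) p ≤-refl ap dp core ,
  λ i → ISignature.φ-agree k (s≤s z≤n) (toℕ i) p ap dp core
  where
    dp : Decreasing p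
    dp = linked⇒decreasing p linked
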